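{- The map $T\mapsto\Phi(T)$ is a bijection between the admissible triangulations of the infinite strip $\mathbb{V}(\mathbb{Z},\varnothing)$ (i.e. admissible triangulations of the $\infty$-gon) and the infinite friezes with enough ones.
   Context: $\mathbb{V}(\mathbb{Z},\varnothing)$ is the strip $\mathbb{R}\times[0,1]$ with marked points $(i,0)$, $i\in\mathbb{Z}$, on the lower boundary and none on the upper boundary. An arc is a non-contractible curve whose endpoints are marked points, up to isotopy fixing endpoints (so all arcs are peripheral, joining $(i,0)$ and $(j,0)$ with $|i-j|\ge 2$); a triangulation is a maximal collection of pairwise non-crossing arcs; it is admissible if every marked point is incident with only finitely many of its arcs. An infinite frieze is a map $t:\mathbb{Z}\times\mathbb{Z}\to\mathbb{Z}$ with $t(i,i)=0$; $t(i,j)\ge1$ for $i<j$ and $t(i,i+1)=1$; $t(i,j)=-t(j,i)$; and $t(i,j)t(i+1,j+1)-t(i,j+1)t(i+1,j)=1$ for all $i,j$; it is uniquely determined by its quiddity sequence $a_i=t(i-1,i+1)$. $\Phi(T)$ is the infinite frieze whose quiddity sequence is $a_i=$ number of triangles of $T$ incident with $(i,0)$. An infinite frieze $t$ has enough ones if for all $i\le j$ there exist $i'\le i\le j\le j'$ with $t(i',j')=1$. -}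

module Defs where

open import Data.Bool using (Bool; true; false)
open import Data.Nat using (ℕ)
open import Data.Integer using (ℤ; +_; _+_; _-_; _*_; -_; _≤_; _<_)
open import Data.Product using (Σ; _×_; ∃; ∃-syntax)
open import Data.Sum using (_⊎_)
open import Data.List using (List; length)
open import Data.List.Membership.Propositional using (_∈_)
open import Data.List.Relation.Unary.Unique.Propositional using (Unique)
open import Relation.Nullary using (¬_)
open import Relation.Binary.PropositionalEquality using (_≡_)

-- Marked points (i,0) are identified with i : ℤ.
-- The strip is simply connected, so an arc is determined by its two
-- endpoints; we record an arc as a pair (i , j) with i + 2 ≤ j.

IsArc : ℤ → ℤ → Set
IsArc i j = i + + 2 ≤ j

ArcSet : Set
ArcSet = ℤ → ℤ → Bool

OnlyArcs : ArcSet → Set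
OnlyArcs T = ∀ i j → T i j ≡ true → IsArc i j

Cross : ℤ → ℤ → ℤ → ℤ → Set
Cross i j k l = (i < k × k < j × j < l) ⊎ (k < i × i < l × l < j)

PairwiseNonCrossing : ArcSet → Set
PairwiseNonCrossing T =
  ∀ i j k l → T i j ≡ true → T k l ≡ true → ¬ Cross i j k l

Maximal : ArcSet → Set
Maximal T = ∀ i j → IsArc i j → T i j ≡ false →
  ¬ (∀ k l → T k l ≡ true → ¬ Cross i j k l)

IsTriangulation : ArcSet → Set
IsTriangulation T = OnlyArcs T × PairwiseNonCrossing T × Maximal T

-- Every marked point is incident with only finitely many arcs of T:
-- the other endpoints of arcs at i are all contained in some finite list.
Admissible : ArcSet → Set
Admissible T = ∀ i → ∃[ L ] (∀ j → (T i j ≡ true ⊎ T j i ≡ true) → j ∈ L)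

AdmissibleTriangulation : ArcSet → Set
AdmissibleTriangulation T = IsTriangulation T × Admissible T

-- Triangles of T.  A side between a < b is either a boundary segment
-- (b = a + 1) or an arc of T.  A triangle is a triple a < b < c whose
-- three sides are sides of T.

Side : ArcSet → ℤ → ℤ → Set
Side T a b = (b ≡ a + + 1) ⊎ (T a b ≡ true)

Triple : Set
Triple = ℤ × ℤ × ℤ

IsTriangle : ArcSet → Triple → Set
IsTriangle T (a Data.Product., b Data.Product., c) =
  a < b × b < c × Side T a b × Side T b c × Side T a c

IncidentWith : ℤ → Triple → Set
IncidentWith i (a Data.Product., b Data.Product., c) = (i ≡ a) ⊎ (i ≡ b) ⊎ (i ≡ c)

TriangleCount : ArcSet → ℤ → ℕ → Set
TriangleCount T i n = ∃[ L ]
  ( Unique L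
  × (∀ x → x ∈ L → IsTriangle T x × IncidentWith i x)
  × (∀ x → IsTriangle T x → IncidentWith i x → x ∈ L)
  × length L ≡ n )

IsInfiniteFrieze : (ℤ → ℤ → ℤ) → Set
IsInfiniteFrieze t =
    (∀ i → t i i ≡ + 0)
  × (∀ i j → i < j → + 1 ≤ t i j)
  × (∀ i → t i (i + + 1) ≡ + 1)
  × (∀ i j → t i j ≡ - t j i)
  × (∀ i j → t i j * t (i + + 1) (j + + 1) - t i (j + + 1) * t (i + + 1) j ≡ + 1)

quiddity : (ℤ → ℤ → ℤ) → ℤ → ℤ
quiddity t i = t (i - + 1) (i + + 1)

EnoughOnes : (ℤ → ℤ → ℤ) → Set
EnoughOnes t = ∀ i j → i ≤ j →
  ∃[ i' ] ∃[ j' ] (i' ≤ i × j ≤ j' × t i' j' ≡ + 1)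

IsΦ : ArcSet → (ℤ → ℤ → ℤ) → Set
IsΦ T t = IsInfiniteFrieze t
  × (∀ i → Σ ℕ λ n → TriangleCount T i n × quiddity t i ≡ + n)

module Submission where

-- A frieze is determined by its quiddity sequence a: with v : ℤ → ℤ² solving
-- v(c+1) = a(c) v(c) - v(c-1) and det(v c, v(c+1)) = 1, one has t(i,j) = det(v i, v j).
-- For a triangulation T with triangle counts a, det(v p, v q) = 1 on every side (p,q):
-- a side is the outer side of the middle triangle at its apex, and the two fans of
-- triangles at that apex telescope through the recurrence. Expanding in these unimodular
-- bases shows det(v i, v j) ≥ 1 for i < j, with equality exactly on the sides of T.
-- Hence Φ(T) is an infinite frieze with enough ones whose ones above the diagonal are
-- precisely the sides of T, which gives injectivity. Conversely, for a frieze t with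
-- enough ones the pairs with t = 1 do not cross (Plücker), and every such arc splits at a
-- Farey point into two more, so they form a maximal admissible triangulation; the same fan
-- computation identifies its triangle counts with the quiddity sequence of t.

open import Defs
open import Data.Integer using (ℤ)
open import Data.Product using (Σ; _×_)
open import Relation.Binary.PropositionalEquality using (_≡_)

open import Data.Bool using (true; false; _∧_)
import Data.Bool as Bool
open import Data.Bool.Properties using (⇔→≡)
open import Data.Nat as ℕ using (ℕ; zero; suc)
import Data.Nat.Properties as ℕP
open import Data.Integer as ℤ using (+_; -[1+_]; _+_; _-_; _*_; -_; _≤_; _<_; +≤+; +<+)
import Data.Integer.Properties as ℤP
open import Data.Integer.Tactic.RingSolver using (solve-∀)
open import Data.Product using (_,_; proj₁; proj₂)
open import Data.Sum using (_⊎_; inj₁; inj₂)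
open import Data.Empty using (⊥; ⊥-elim)
open import Data.List using (List; []; _∷_; length; _++_)
open import Data.List.Properties using (length-++)
open import Data.List.Extrema ℤP.≤-totalOrder using (min; max; min≤⊤; min≤xs; ⊥≤max; xs≤max)
open import Data.List.Membership.Propositional using (_∈_)
open import Data.List.Membership.Propositional.Properties using (∈-∃++; ∈-++⁻; ∈-++⁺ˡ; ∈-++⁺ʳ)
open import Data.List.Relation.Unary.Any using (here; there)
open import Data.List.Relation.Unary.All as All using (All; []; _∷_)
open import Data.List.Relation.Unary.AllPairs using ([]; _∷_)
open import Data.List.Relation.Unary.Unique.Propositional using (Unique)
import Data.List.Relation.Unary.Unique.Propositional.Properties as Unique
open import Function.Bundles using (mk⇔)
open import Relation.Nullary using (¬_; Dec; yes; no; does)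
open import Relation.Nullary.Decidable using (_×-dec_)
open import Relation.Unary using (Decidable)
open import Relation.Binary using (tri<; tri≈; tri>)
open import Relation.Binary.PropositionalEquality
  using (refl; sym; trans; cong; cong₂; subst; subst₂; _≢_; module ≡-Reasoning)

i+1≤j⇒i<j : ∀ {i j} → i + + 1 ≤ j → i < j
i+1≤j⇒i<j {i} {j} p = ℤP.suc[i]≤j⇒i<j (subst (_≤ j) (ℤP.+-comm i (+ 1)) p)

i<j⇒i+1≤j : ∀ {i j} → i < j → i + + 1 ≤ j
i<j⇒i+1≤j {i} {j} p = subst (_≤ j) (ℤP.+-comm (+ 1) i) (ℤP.i<j⇒suc[i]≤j p)

i<i+1 : ∀ i → i < i + + 1
i<i+1 i = i+1≤j⇒i<j ℤP.≤-refl

i<j⇒j≮i+1 : ∀ {i j} → i < j → ¬ j < i + + 1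
i<j⇒j≮i+1 p q = ℤP.<-irrefl refl (ℤP.<-≤-trans q (i<j⇒i+1≤j p))

i<j+1⇒i≤j : ∀ {i j} → i < j + + 1 → i ≤ j
i<j+1⇒i≤j q = ℤP.≮⇒≥ (λ j<i → i<j⇒j≮i+1 j<i q)

i≤j⇒i≡j⊎i<j : ∀ {i j} → i ≤ j → i ≡ j ⊎ i < j
i≤j⇒i≡j⊎i<j {i} {j} p with i ℤ.≟ j
... | yes e = inj₁ e
... | no ne = inj₂ (ℤP.≤∧≢⇒< p ne)

i<j⇒j≡i+1⊎i+1<j : ∀ {i j} → i < j → j ≡ i + + 1 ⊎ i + + 1 < j
i<j⇒j≡i+1⊎i+1<j p with i≤j⇒i≡j⊎i<j (i<j⇒i+1≤j p)
... | inj₁ e = inj₁ (sym e)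
... | inj₂ q = inj₂ q

i-1+1≡i : ∀ i → i - + 1 + + 1 ≡ i
i-1+1≡i = solve-∀

i+1-1≡i : ∀ i → i + + 1 - + 1 ≡ i
i+1-1≡i = solve-∀

i+2≡i+1+1 : ∀ i → i + + 2 ≡ i + + 1 + + 1
i+2≡i+1+1 i = sym (ℤP.+-assoc i (+ 1) (+ 1))

i+[1+n]≡i+1+n : ∀ i n → i + + suc n ≡ i + + 1 + + n
i+[1+n]≡i+1+n i n = sym (ℤP.+-assoc i (+ 1) (+ n))

i-1<i : ∀ i → i - + 1 < i
i-1<i i = subst (i - + 1 <_) (i-1+1≡i i) (i<i+1 (i - + 1))

i<j⇒i≤j-1 : ∀ {i j} → i < j → i ≤ j - + 1
i<j⇒i≤j-1 {i} {j} p = i<j+1⇒i≤j (subst (i <_) (sym (i-1+1≡i j)) p)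

i≤j⇒j≡i+∣j-i∣ : ∀ {i j} → i ≤ j → j ≡ i + + ℤ.∣ j - i ∣
i≤j⇒j≡i+∣j-i∣ {i} {j} p =
  trans (sym (i+[j-i]≡j i j)) (cong (_+_ i) (sym (ℤP.0≤i⇒+∣i∣≡i (ℤP.i≤j⇒0≤j-i p))))
  where
  i+[j-i]≡j : ∀ i j → i + (j - i) ≡ j
  i+[j-i]≡j = solve-∀

IsArc⇒i+1<j : ∀ i {j} → IsArc i j → i + + 1 < j
IsArc⇒i+1<j i {j} arc = i+1≤j⇒i<j (subst (_≤ j) (i+2≡i+1+1 i) arc)

i+1<j⇒IsArc : ∀ i {j} → i + + 1 < j → IsArc i j
i+1<j⇒IsArc i {j} i+1<j = subst (_≤ j) (sym (i+2≡i+1+1 i)) (i<j⇒i+1≤j i+1<j)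

i<j⇒0<j-i : ∀ {i j} → i < j → + 0 < j - i
i<j⇒0<j-i {i} {j} p = subst (_< j - i) (ℤP.+-inverseʳ i) (ℤP.+-monoˡ-< (- i) p)

OnSubintervals : (ℤ → ℤ → Set) → ℤ → ℤ → Set
OnSubintervals P a b = ∀ a' b' → a ≤ a' → b' ≤ b → a' < b' → a < a' ⊎ b' < b → P a' b'

interval-induction : (P : ℤ → ℤ → Set) →
  (∀ a b → a < b → OnSubintervals P a b → P a b) → ∀ a b → a < b → P a b
interval-induction P step a b a<b =
  go ℤ.∣ b - a ∣ a b a<b (ℤP.≤-reflexive (sym (ℤP.0≤i⇒+∣i∣≡i (ℤP.<⇒≤ (i<j⇒0<j-i a<b)))))
  where
  narrower : ∀ {a b a' b'} → a ≤ a' → b' ≤ b → a < a' ⊎ b' < b → b' - a' < b - a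
  narrower {a} {b} {a'} {b'} p q (inj₁ r) =
    ℤP.≤-<-trans (ℤP.+-monoˡ-≤ (- a') q) (ℤP.+-monoʳ-< b (ℤP.neg-mono-< r))
  narrower {a} {b} {a'} {b'} p q (inj₂ r) =
    ℤP.<-≤-trans (ℤP.+-monoˡ-< (- a') r) (ℤP.+-monoʳ-≤ b (ℤP.neg-mono-≤ p))
  go : ∀ n a b → a < b → b - a ≤ + n → P a b
  go zero a b a<b w = ⊥-elim (ℤP.<-irrefl refl (ℤP.<-≤-trans (i<j⇒0<j-i a<b) w))
  go (suc n) a b a<b w = step a b a<b λ a' b' p q a'<b' r →
    go n a' b' a'<b' (i<j+1⇒i≤j (ℤP.<-≤-trans (narrower p q r)
      (subst (b - a ≤_) (cong +_ (ℕP.+-comm 1 n)) w)))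

module _ {P : ℤ → ℤ → Set} {a b c : ℤ} (ih : OnSubintervals P a b) (a<c : a < c) (c<b : c < b) where

  onLeft : P a c
  onLeft = ih a c ℤP.≤-refl (ℤP.<⇒≤ c<b) a<c (inj₂ c<b)

  onRight : P c b
  onRight = ih c b (ℤP.<⇒≤ a<c) ℤP.≤-refl c<b (inj₁ a<c)

Minimum Maximum : (ℤ → Set) → Set
Minimum P = Σ ℤ λ x → P x × (∀ y → P y → x ≤ y)
Maximum P = Σ ℤ λ x → P x × (∀ y → P y → y ≤ x)

minimum : (P : ℤ → Set) → Decidable P → ∀ m → (∀ x → P x → m ≤ x) → ∀ w → P w → Minimum P
minimum P P? m m≤P w Pw = go ℤ.∣ w - m ∣ m m≤P (ℤP.≤-reflexive (i≤j⇒j≡i+∣j-i∣ (m≤P w Pw)))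
  where
  go : ∀ n s → (∀ y → P y → s ≤ y) → w ≤ s + + n → Minimum P
  go n s s≤P w≤s+n with P? s
  ... | yes Ps = s , Ps , s≤P
  go zero s s≤P w≤s | no ¬Ps =
    ⊥-elim (¬Ps (subst P (ℤP.≤-antisym (subst (w ≤_) (ℤP.+-identityʳ s) w≤s) (s≤P w Pw)) Pw))
  go (suc n) s s≤P w≤s+n | no ¬Ps = go n (s + + 1) s+1≤P (subst (w ≤_) (i+[1+n]≡i+1+n s n) w≤s+n)
    where
    s+1≤P : ∀ y → P y → s + + 1 ≤ y
    s+1≤P y Py with i≤j⇒i≡j⊎i<j (s≤P y Py)
    ... | inj₁ refl = ⊥-elim (¬Ps Py)
    ... | inj₂ s<y = i<j⇒i+1≤j s<y

maximum : (P : ℤ → Set) → Decidable P → ∀ M → (∀ x → P x → x ≤ M) → ∀ w → P w → Maximum P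
maximum P P? M P≤M w Pw with minimum (λ y → P (- y)) (λ y → P? (- y)) (- M)
    (λ x Px → subst (- M ≤_) (ℤP.neg-involutive x) (ℤP.neg-mono-≤ (P≤M (- x) Px)))
    (- w) (subst P (sym (ℤP.neg-involutive w)) Pw)
... | x , P-x , x≤ = - x , P-x , λ y Py →
  subst (_≤ - x) (ℤP.neg-involutive y) (ℤP.neg-mono-≤ (x≤ (- y) (subst P (sym (ℤP.neg-involutive y)) Py)))

range : ℤ → ℕ → List ℤ
range a zero = a ∷ []
range a (suc n) = a ∷ range (a + + 1) n

∈-range : ∀ n a x → a ≤ x → x ≤ a + + n → x ∈ range a n
∈-range zero a x p q = here (ℤP.≤-antisym (subst (x ≤_) (ℤP.+-identityʳ a) q) p)
∈-range (suc n) a x p q with i≤j⇒i≡j⊎i<j p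
... | inj₁ e = here (sym e)
... | inj₂ a<x = there (∈-range n (a + + 1) x (i<j⇒i+1≤j a<x) (subst (x ≤_) (i+[1+n]≡i+1+n a n) q))

∈-range-between : ∀ a b x → a ≤ x → x ≤ b → x ∈ range a ℤ.∣ b - a ∣
∈-range-between a b x p q = ∈-range _ a x p (subst (x ≤_) (i≤j⇒j≡i+∣j-i∣ (ℤP.≤-trans p q)) q)

module _ {A : Set} where

  private
    drop-∈ : ∀ {x y : A} (ys zs : List A) → y ≢ x → y ∈ ys ++ x ∷ zs → y ∈ ys ++ zs
    drop-∈ [] zs y≢x (here y≡x) = ⊥-elim (y≢x y≡x)
    drop-∈ [] zs y≢x (there p) = p
    drop-∈ (w ∷ ys) zs y≢x (here e) = here e
    drop-∈ (w ∷ ys) zs y≢x (there p) = there (drop-∈ ys zs y≢x p)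

    length-++-∷ : ∀ (ys zs : List A) x → length (ys ++ x ∷ zs) ≡ suc (length (ys ++ zs))
    length-++-∷ [] zs x = refl
    length-++-∷ (w ∷ ys) zs x = cong suc (length-++-∷ ys zs x)

  Unique∧⊆⇒length≤ : ∀ (xs ys : List A) → Unique xs → (∀ x → x ∈ xs → x ∈ ys) → length xs ℕ.≤ length ys
  Unique∧⊆⇒length≤ [] ys u sub = ℕ.z≤n
  Unique∧⊆⇒length≤ (x ∷ xs) ys (x∉xs ∷ u) sub with ∈-∃++ (sub x (here refl))
  ... | ys₁ , ys₂ , refl = subst (suc (length xs) ℕ.≤_) (sym (length-++-∷ ys₁ ys₂ x))
    (ℕ.s≤s (Unique∧⊆⇒length≤ xs (ys₁ ++ ys₂) u λ y y∈ →
      drop-∈ ys₁ ys₂ (λ y≡x → All.lookup x∉xs y∈ (sym y≡x)) (sub y (there y∈))))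

  Unique∧⊆∧⊇⇒length≡ : ∀ (xs ys : List A) → Unique xs → Unique ys →
    (∀ x → x ∈ xs → x ∈ ys) → (∀ x → x ∈ ys → x ∈ xs) → length xs ≡ length ys
  Unique∧⊆∧⊇⇒length≡ xs ys u v p q =
    ℕP.≤-antisym (Unique∧⊆⇒length≤ xs ys u p) (Unique∧⊆⇒length≤ ys xs v q)

ℤ² : Set
ℤ² = ℤ × ℤ

det : ℤ² → ℤ² → ℤ
det (a , b) (c , d) = a * d - b * c

infixl 6 _⊕_ _⊝_
infixl 7 _·_

_⊕_ _⊝_ : ℤ² → ℤ² → ℤ²
(a , b) ⊕ (c , d) = a + c , b + d
(a , b) ⊝ (c , d) = a - c , b - d

_·_ : ℤ → ℤ² → ℤ²
k · (a , b) = k * a , k * b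

det-self : ∀ x → det x x ≡ + 0
det-self (x₁ , x₂) = lemma x₁ x₂
  where lemma : ∀ x₁ x₂ → x₁ * x₂ - x₂ * x₁ ≡ + 0
        lemma = solve-∀

det-anti : ∀ x y → det x y ≡ - det y x
det-anti (x₁ , x₂) (y₁ , y₂) = lemma x₁ x₂ y₁ y₂
  where lemma : ∀ x₁ x₂ y₁ y₂ → x₁ * y₂ - x₂ * y₁ ≡ - (y₁ * x₂ - y₂ * x₁)
        lemma = solve-∀

det-·ˡ : ∀ k x y → det (k · x) y ≡ k * det x y
det-·ˡ k (x₁ , x₂) (y₁ , y₂) = lemma k x₁ x₂ y₁ y₂
  where lemma : ∀ k x₁ x₂ y₁ y₂ → (k * x₁) * y₂ - (k * x₂) * y₁ ≡ k * (x₁ * y₂ - x₂ * y₁)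
        lemma = solve-∀

det-⊝ʳ : ∀ x y → det x (y ⊝ x) ≡ det x y
det-⊝ʳ (x₁ , x₂) (y₁ , y₂) = lemma x₁ x₂ y₁ y₂
  where lemma : ∀ x₁ x₂ y₁ y₂ → x₁ * (y₂ - x₂) - x₂ * (y₁ - x₁) ≡ x₁ * y₂ - x₂ * y₁
        lemma = solve-∀

plücker : ∀ a b c d → det a b * det c d ≡ det a c * det b d - det a d * det b c
plücker (a₁ , a₂) (b₁ , b₂) (c₁ , c₂) (d₁ , d₂) = lemma a₁ a₂ b₁ b₂ c₁ c₂ d₁ d₂
  where
  lemma : ∀ a₁ a₂ b₁ b₂ c₁ c₂ d₁ d₂ →
    (a₁ * b₂ - a₂ * b₁) * (c₁ * d₂ - c₂ * d₁)
      ≡ (a₁ * c₂ - a₂ * c₁) * (b₁ * d₂ - b₂ * d₁) - (a₁ * d₂ - a₂ * d₁) * (b₁ * c₂ - b₂ * c₁)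
  lemma = solve-∀

cramer : ∀ x c w → det x c ≡ + 1 → w ≡ det w c · x ⊕ det x w · c
cramer (x₁ , x₂) (c₁ , c₂) (w₁ , w₂) e =
  cong₂ _,_ (trans (scale w₁) (lemma₁ x₁ x₂ c₁ c₂ w₁ w₂)) (trans (scale w₂) (lemma₂ x₁ x₂ c₁ c₂ w₁ w₂))
  where
  scale : ∀ w → w ≡ (x₁ * c₂ - x₂ * c₁) * w
  scale w = trans (sym (ℤP.*-identityˡ w)) (cong (_* w) (sym e))
  lemma₁ : ∀ x₁ x₂ c₁ c₂ w₁ w₂ →
    (x₁ * c₂ - x₂ * c₁) * w₁ ≡ (w₁ * c₂ - w₂ * c₁) * x₁ + (x₁ * w₂ - x₂ * w₁) * c₁
  lemma₁ = solve-∀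
  lemma₂ : ∀ x₁ x₂ c₁ c₂ w₁ w₂ →
    (x₁ * c₂ - x₂ * c₁) * w₂ ≡ (w₁ * c₂ - w₂ * c₁) * x₂ + (x₁ * w₂ - x₂ * w₁) * c₂
  lemma₂ = solve-∀

1·x≡x : ∀ x → + 1 · x ≡ x
1·x≡x (x₁ , x₂) = cong₂ _,_ (ℤP.*-identityˡ x₁) (ℤP.*-identityˡ x₂)

unimodular-triangle : ∀ x y z → det x y ≡ + 1 → det y z ≡ + 1 → det x z ≡ + 1 → y ≡ x ⊕ z
unimodular-triangle x y z xy yz xz = begin
  y                           ≡⟨ cramer x z y xz ⟩
  det y z · x ⊕ det x y · z   ≡⟨ cong₂ (λ p q → p · x ⊕ q · z) yz xy ⟩
  + 1 · x ⊕ + 1 · z           ≡⟨ cong₂ _⊕_ (1·x≡x x) (1·x≡x z) ⟩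
  x ⊕ z                       ∎
  where open ≡-Reasoning

det-expand : ∀ A B C α β γ δ → det A C ≡ + 1 → det A B ≡ + 1 → det C B ≡ + 1 →
  det (α · A ⊕ β · C) (γ · C ⊕ δ · B) ≡ α * γ + α * δ + β * δ
det-expand (a₁ , a₂) (b₁ , b₂) (c₁ , c₂) α β γ δ AC AB CB =
  trans (lemma a₁ a₂ b₁ b₂ c₁ c₂ α β γ δ) (units AC AB CB)
  where
  lemma : ∀ a₁ a₂ b₁ b₂ c₁ c₂ α β γ δ →
    (α * a₁ + β * c₁) * (γ * c₂ + δ * b₂) - (α * a₂ + β * c₂) * (γ * c₁ + δ * b₁)
      ≡ α * γ * (a₁ * c₂ - a₂ * c₁) + α * δ * (a₁ * b₂ - a₂ * b₁) + β * δ * (c₁ * b₂ - c₂ * b₁)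
  lemma = solve-∀
  units : ∀ {x y z} → x ≡ + 1 → y ≡ + 1 → z ≡ + 1 →
    α * γ * x + α * δ * y + β * δ * z ≡ α * γ + α * δ + β * δ
  units refl refl refl =
    cong₂ _+_ (cong₂ _+_ (ℤP.*-identityʳ (α * γ)) (ℤP.*-identityʳ (α * δ))) (ℤP.*-identityʳ (β * δ))

module Recurrence (a : ℤ → ℤ) where

  private
    e₁ e₂ : ℤ²
    e₁ = + 1 , + 0
    e₂ = + 0 , + 1

    step : ℤ → ℤ² × ℤ² → ℤ² × ℤ²
    step c (x , y) = y , a (c + + 1) · y ⊝ x

    forward : ℕ → ℤ² × ℤ²
    forward zero = e₁ , e₂
    forward (suc k) = step (+ k) (forward k)

    backward : ℕ → ℤ² × ℤ²
    backward zero = e₁ , e₂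
    backward (suc k) = let (x , y) = backward k in a (- + k) · x ⊝ y , x

    pair : ℤ → ℤ² × ℤ²
    pair (+ k) = forward k
    pair -[1+ k ] = backward (suc k)

    undo : ∀ k z w → w ≡ k · z ⊝ (k · z ⊝ w)
    undo k (z₁ , z₂) (w₁ , w₂) = cong₂ _,_ (lemma k z₁ w₁) (lemma k z₂ w₂)
      where lemma : ∀ k z w → w ≡ k * z - (k * z - w)
            lemma = solve-∀

    pair-step : ∀ c → pair (c + + 1) ≡ step c (pair c)
    pair-step (+ k) = subst (λ m → forward m ≡ step (+ k) (forward k)) (ℕP.+-comm 1 k) refl
    pair-step -[1+ zero ] = cong (e₁ ,_) (undo (a (+ 0)) e₁ e₂)
    pair-step -[1+ suc k ] = let (x , y) = backward (suc k) in cong (x ,_) (undo (a -[1+ k ]) x y)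

    det-step : ∀ k x y → det y (k · y ⊝ x) ≡ det x y
    det-step k (x₁ , x₂) (y₁ , y₂) = lemma k x₁ x₂ y₁ y₂
      where lemma : ∀ k x₁ x₂ y₁ y₂ → y₁ * (k * y₂ - x₂) - y₂ * (k * y₁ - x₁) ≡ x₁ * y₂ - x₂ * y₁
            lemma = solve-∀

    det-unstep : ∀ k x y → det (k · x ⊝ y) x ≡ det x y
    det-unstep k (x₁ , x₂) (y₁ , y₂) = lemma k x₁ x₂ y₁ y₂
      where lemma : ∀ k x₁ x₂ y₁ y₂ → (k * x₁ - y₁) * x₂ - (k * x₂ - y₂) * x₁ ≡ x₁ * y₂ - x₂ * y₁
            lemma = solve-∀

    det-forward : ∀ k → det (proj₁ (forward k)) (proj₂ (forward k)) ≡ + 1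
    det-forward zero = refl
    det-forward (suc k) = trans (det-step (a (+ k + + 1)) (proj₁ (forward k)) (proj₂ (forward k))) (det-forward k)

    det-backward : ∀ k → det (proj₁ (backward k)) (proj₂ (backward k)) ≡ + 1
    det-backward zero = refl
    det-backward (suc k) = trans (det-unstep (a (- + k)) (proj₁ (backward k)) (proj₂ (backward k))) (det-backward k)

    det-pair : ∀ c → det (proj₁ (pair c)) (proj₂ (pair c)) ≡ + 1
    det-pair (+ k) = det-forward k
    det-pair -[1+ k ] = det-backward (suc k)

  v : ℤ → ℤ²
  v c = proj₁ (pair c)

  private
    v-next : ∀ c → v (c + + 1) ≡ proj₂ (pair c)
    v-next c = cong proj₁ (pair-step c)

  v-det : ∀ c → det (v c) (v (c + + 1)) ≡ + 1
  v-det c = trans (cong (det (v c)) (v-next c)) (det-pair c)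

  v-rec : ∀ c → v (c + + 1) ≡ a c · v c ⊝ v (c - + 1)
  v-rec c = trans (v-next c) (subst (λ d → proj₂ (pair d) ≡ a c · v d ⊝ v (c - + 1)) (i-1+1≡i c) rec)
    where
    d : ℤ
    d = c - + 1
    rec : proj₂ (pair (d + + 1)) ≡ a c · v (d + + 1) ⊝ v d
    rec = trans (cong proj₂ (pair-step d))
      (subst (λ e → a e · proj₂ (pair d) ⊝ proj₁ (pair d) ≡ a c · v (d + + 1) ⊝ v d)
        (sym (i-1+1≡i c)) (cong (λ z → a c · z ⊝ v d) (sym (v-next d))))

record IsSL₂Frieze (t : ℤ → ℤ → ℤ) : Set where
  field
    diagonal : ∀ i → t i i ≡ + 0
    boundary : ∀ i → t i (i + + 1) ≡ + 1
    antisym : ∀ i j → t i j ≡ - t j i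
    diamond : ∀ i j → t i j * t (i + + 1) (j + + 1) - t i (j + + 1) * t (i + + 1) j ≡ + 1

  diamond-below : ∀ i j → t i j * t (i + + 1) (j - + 1) ≡ t i (j - + 1) * t (i + + 1) j - + 1
  diamond-below i j = trans (solve₁ (t i (j - + 1) * t (i + + 1) j) (t i j * t (i + + 1) (j - + 1)))
    (cong (_-_ (t i (j - + 1) * t (i + + 1) j))
      (subst (λ k → t i (j - + 1) * t (i + + 1) k - t i k * t (i + + 1) (j - + 1) ≡ + 1)
        (i-1+1≡i j) (diamond i (j - + 1))))
    where
    solve₁ : ∀ p q → q ≡ p - (p - q)
    solve₁ = solve-∀

IsInfiniteFrieze⇒IsSL₂Frieze : ∀ {t} → IsInfiniteFrieze t → IsSL₂Frieze t
IsInfiniteFrieze⇒IsSL₂Frieze (diagonal , _ , boundary , antisym , diamond) =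
  record { diagonal = diagonal ; boundary = boundary ; antisym = antisym ; diamond = diamond }

detFrieze : (ℤ → ℤ²) → ℤ → ℤ → ℤ
detFrieze v i j = det (v i) (v j)

detFrieze-isSL₂Frieze : ∀ v → (∀ c → det (v c) (v (c + + 1)) ≡ + 1) → IsSL₂Frieze (detFrieze v)
detFrieze-isSL₂Frieze v v-det = record
  { diagonal = λ i → det-self (v i)
  ; boundary = v-det
  ; antisym = λ i j → det-anti (v i) (v j)
  ; diamond = λ i j → trans (sym (plücker (v i) (v (i + + 1)) (v j) (v (j + + 1)))) (cong₂ _*_ (v-det i) (v-det j))
  }

quiddity-detFrieze : ∀ a c → quiddity (detFrieze (Recurrence.v a)) c ≡ a c
quiddity-detFrieze a c = begin
  det (v (c - + 1)) (v (c + + 1))                  ≡⟨ cong (det (v (c - + 1))) (v-rec c) ⟩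
  det (v (c - + 1)) (a c · v c ⊝ v (c - + 1))      ≡⟨ det-·ʳ-⊝ (a c) (v (c - + 1)) (v c) ⟩
  a c * det (v (c - + 1)) (v c)                    ≡⟨ cong (a c *_) v-det′ ⟩
  a c * + 1                                        ≡⟨ ℤP.*-identityʳ (a c) ⟩
  a c                                              ∎
  where
  open Recurrence a
  open ≡-Reasoning
  det-·ʳ-⊝ : ∀ k x y → det x (k · y ⊝ x) ≡ k * det x y
  det-·ʳ-⊝ k (x₁ , x₂) (y₁ , y₂) = lemma k x₁ x₂ y₁ y₂
    where lemma : ∀ k x₁ x₂ y₁ y₂ → x₁ * (k * y₂ - x₂) - x₂ * (k * y₁ - x₁) ≡ k * (x₁ * y₂ - x₂ * y₁)
          lemma = solve-∀
  v-det′ : det (v (c - + 1)) (v c) ≡ + 1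
  v-det′ = subst (λ d → det (v (c - + 1)) (v d) ≡ + 1) (i-1+1≡i c) (v-det (c - + 1))

*-cancelʳ-≡-pos : ∀ x y k → + 1 ≤ k → x * k ≡ y * k → x ≡ y
*-cancelʳ-≡-pos x y (+ zero) (+≤+ ())
*-cancelʳ-≡-pos x y (+ suc n) _ = ℤP.*-cancelʳ-≡ x y (+ suc n)

-- Positivity is needed only to cancel t(i+1, j-1) in the diamond rule.
module _ {t s : ℤ → ℤ → ℤ} (tF : IsSL₂Frieze t) (t-pos : ∀ i j → i < j → + 1 ≤ t i j)
         (sF : IsSL₂Frieze s) (same-quiddity : ∀ i → quiddity t i ≡ quiddity s i) where

  private
    module t = IsSL₂Frieze tF
    module s = IsSL₂Frieze sF

    step : ∀ a b → a < b → OnSubintervals (λ i j → t i j ≡ s i j) a b → t a b ≡ s a b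
    step a b a<b ih with i<j⇒j≡i+1⊎i+1<j a<b
    ... | inj₁ refl = trans (t.boundary a) (sym (s.boundary a))
    ... | inj₂ a+1<b with i<j⇒j≡i+1⊎i+1<j a+1<b
    ... | inj₁ refl = subst (λ z → t z (a + + 1 + + 1) ≡ s z (a + + 1 + + 1)) (i+1-1≡i a) (same-quiddity (a + + 1))
    ... | inj₂ a+2<b = *-cancelʳ-≡-pos (t a b) (s a b) (t a' b') (t-pos a' b' a'<b') (begin
        t a b * t a' b'             ≡⟨ t.diamond-below a b ⟩
        t a b' * t a' b - + 1       ≡⟨ cong₂ (λ x y → x * y - + 1) (onLeft ih a<b' b'<b) (onRight ih a<a' a'<b) ⟩
        s a b' * s a' b - + 1       ≡⟨ sym (s.diamond-below a b) ⟩
        s a b * s a' b'             ≡⟨ cong (s a b *_) (sym (ih a' b' (ℤP.<⇒≤ a<a') (ℤP.<⇒≤ b'<b) a'<b' (inj₁ a<a'))) ⟩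
        s a b * t a' b'             ∎)
      where
      open ≡-Reasoning
      a' b' : ℤ
      a' = a + + 1
      b' = b - + 1
      a<a' : a < a'
      a<a' = i<i+1 a
      a'<b' : a' < b'
      a'<b' = i+1≤j⇒i<j (i<j⇒i≤j-1 a+2<b)
      a<b' : a < b'
      a<b' = ℤP.<-trans a<a' a'<b'
      b'<b : b' < b
      b'<b = i-1<i b
      a'<b : a' < b
      a'<b = ℤP.<-trans a'<b' b'<b

    above-diagonal : ∀ i j → i < j → t i j ≡ s i j
    above-diagonal = interval-induction (λ i j → t i j ≡ s i j) step

  frieze-unique : ∀ i j → t i j ≡ s i j
  frieze-unique i j with ℤP.<-cmp i j
  ... | tri< i<j _ _ = above-diagonal i j i<j
  ... | tri≈ _ refl _ = trans (t.diagonal i) (sym (s.diagonal i))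
  ... | tri> _ _ j<i = trans (t.antisym i j) (trans (cong -_ (above-diagonal j i j<i)) (sym (s.antisym i j)))

-- X = v(c-1) and Y = v(c+1) are reached from the far ends A, B of the middle triangle
-- at c by fans of l and r triangles, and the recurrence at c has coefficient k.
fan-closes : ∀ A B C X Y l r → X ≡ A ⊕ l · C → Y ≡ B ⊕ r · C → Y ≡ (l + (+ 1 + r)) · C ⊝ X →
  B ≡ C ⊝ A
fan-closes A B C X Y l r X≡ Y≡ Y-rec = begin
  B                                       ≡⟨ add-sub B C r ⟩
  B ⊕ r · C ⊝ r · C
    ≡⟨ cong (_⊝ r · C) (trans (sym Y≡) (trans Y-rec (cong ((l + (+ 1 + r)) · C ⊝_) X≡))) ⟩
  (l + (+ 1 + r)) · C ⊝ (A ⊕ l · C) ⊝ r · C ≡⟨ collect A C l r ⟩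
  C ⊝ A                                   ∎
  where
  open ≡-Reasoning
  add-sub : ∀ B C r → B ≡ B ⊕ r · C ⊝ r · C
  add-sub (b₁ , b₂) (c₁ , c₂) r = cong₂ _,_ (lemma b₁ c₁ r) (lemma b₂ c₂ r)
    where lemma : ∀ b c r → b ≡ (b + r * c) - r * c
          lemma = solve-∀
  collect : ∀ A C l r → (l + (+ 1 + r)) · C ⊝ (A ⊕ l · C) ⊝ r · C ≡ C ⊝ A
  collect (a₁ , a₂) (c₁ , c₂) l r = cong₂ _,_ (lemma a₁ c₁ l r) (lemma a₂ c₂ l r)
    where lemma : ∀ a c l r → (l + (+ 1 + r)) * c - (a + l * c) - r * c ≡ c - a
          lemma = solve-∀

fan-coefficient : ∀ A B C X Y D l r k → X ≡ A ⊕ l · C → Y ≡ B ⊕ r · C → Y ≡ k · C ⊝ X →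
  C ≡ A ⊕ B → det C D ≡ + 1 → k ≡ l + (+ 1 + r)
fan-coefficient A B C X Y D l r k X≡ Y≡ Y-rec C≡ CD = begin
  k                            ≡⟨ sym (det-scaled k) ⟩
  det (k · C) D                ≡⟨ cong (λ z → det z D) kC≡ ⟩
  det ((l + (+ 1 + r)) · C) D  ≡⟨ det-scaled (l + (+ 1 + r)) ⟩
  l + (+ 1 + r)                ∎
  where
  open ≡-Reasoning
  det-scaled : ∀ m → det (m · C) D ≡ m
  det-scaled m = trans (det-·ˡ m C D) (trans (cong (m *_) CD) (ℤP.*-identityʳ m))
  sub-add : ∀ X C k → k · C ≡ X ⊕ (k · C ⊝ X)
  sub-add (x₁ , x₂) (c₁ , c₂) k = cong₂ _,_ (lemma x₁ c₁ k) (lemma x₂ c₂ k)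
    where lemma : ∀ x c k → k * c ≡ x + (k * c - x)
          lemma = solve-∀
  collect : ∀ A B l r → (A ⊕ l · (A ⊕ B)) ⊕ (B ⊕ r · (A ⊕ B)) ≡ (l + (+ 1 + r)) · (A ⊕ B)
  collect (a₁ , a₂) (b₁ , b₂) l r = cong₂ _,_ (lemma a₁ b₁ l r) (lemma a₂ b₂ l r)
    where lemma : ∀ a b l r → (a + l * (a + b)) + (b + r * (a + b)) ≡ (l + (+ 1 + r)) * (a + b)
          lemma = solve-∀
  kC≡ : k · C ≡ (l + (+ 1 + r)) · C
  kC≡ = begin
    k · C                              ≡⟨ sub-add X C k ⟩
    X ⊕ (k · C ⊝ X)                    ≡⟨ cong₂ _⊕_ X≡ (trans (sym Y-rec) Y≡) ⟩
    (A ⊕ l · C) ⊕ (B ⊕ r · C)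
      ≡⟨ subst (λ C → (A ⊕ l · C) ⊕ (B ⊕ r · C) ≡ (l + (+ 1 + r)) · C) (sym C≡) (collect A B l r) ⟩
    (l + (+ 1 + r)) · C                ∎

private
  expansion≡1 : ∀ a b g d → 1 ℕ.≤ a → 1 ℕ.≤ d → a ℕ.* g ℕ.+ a ℕ.* d ℕ.+ b ℕ.* d ≡ 1 → g ≡ 0 × b ≡ 0
  expansion≡1 a zero zero d _ _ _ = refl , refl
  expansion≡1 a b (suc g) d 1≤a 1≤d e = ⊥-elim (ℕP.<-irrefl refl (ℕP.≤-trans
    (ℕP.+-mono-≤ (ℕP.*-mono-≤ 1≤a (ℕ.s≤s (ℕ.z≤n {g}))) (ℕP.*-mono-≤ 1≤a 1≤d))
    (ℕP.≤-trans (ℕP.m≤m+n _ (b ℕ.* d)) (ℕP.≤-reflexive e))))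
  expansion≡1 a (suc b) zero d 1≤a 1≤d e = ⊥-elim (ℕP.<-irrefl refl (ℕP.≤-trans
    (ℕP.+-mono-≤ (ℕP.*-mono-≤ 1≤a 1≤d) (ℕP.*-mono-≤ (ℕ.s≤s (ℕ.z≤n {b})) 1≤d))
    (ℕP.≤-trans (ℕP.+-monoˡ-≤ (suc b ℕ.* d) (ℕP.m≤n+m (a ℕ.* d) (a ℕ.* zero))) (ℕP.≤-reflexive e))))

positive-expansion : ∀ α β γ δ → + 1 ≤ α → + 0 ≤ β → + 0 ≤ γ → + 1 ≤ δ →
  + 1 ≤ α * γ + α * δ + β * δ × (α * γ + α * δ + β * δ ≡ + 1 → γ ≡ + 0 × β ≡ + 0)
positive-expansion (+ a) (+ b) (+ g) (+ d) (+≤+ 1≤a) (+≤+ _) (+≤+ _) (+≤+ 1≤d) =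
  subst (λ z → + 1 ≤ z × (z ≡ + 1 → + g ≡ + 0 × + b ≡ + 0)) (sym as-ℕ)
    ( +≤+ (ℕP.≤-trans (ℕP.*-mono-≤ 1≤a 1≤d)
        (ℕP.≤-trans (ℕP.m≤n+m (a ℕ.* d) (a ℕ.* g)) (ℕP.m≤m+n _ (b ℕ.* d))))
    , λ e → let (g≡0 , b≡0) = expansion≡1 a b g d 1≤a 1≤d (ℤP.+-injective e) in cong +_ g≡0 , cong +_ b≡0)
  where
  as-ℕ : + a * + g + + a * + d + + b * + d ≡ + (a ℕ.* g ℕ.+ a ℕ.* d ℕ.+ b ℕ.* d)
  as-ℕ = trans (cong₂ _+_ (cong₂ _+_ (sym (ℤP.pos-* a g)) (sym (ℤP.pos-* a d))) (sym (ℤP.pos-* b d)))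
           (trans (cong (_+ + (b ℕ.* d)) (sym (ℤP.pos-+ (a ℕ.* g) (a ℕ.* d)))) (sym (ℤP.pos-+ _ (b ℕ.* d))))

pos*pos+pos*pos≢1 : ∀ p q r s → + 1 ≤ p → + 1 ≤ q → + 1 ≤ r → + 1 ≤ s → p * q + r * s ≢ + 1
pos*pos+pos*pos≢1 (+ p) (+ q) (+ r) (+ s) (+≤+ 1≤p) (+≤+ 1≤q) (+≤+ 1≤r) (+≤+ 1≤s) e =
  ℕP.<-irrefl refl
    (ℕP.≤-trans (ℕP.+-mono-≤ (ℕP.*-mono-≤ 1≤p 1≤q) (ℕP.*-mono-≤ 1≤r 1≤s)) (ℕP.≤-reflexive as-ℕ))
  where
  as-ℕ : p ℕ.* q ℕ.+ r ℕ.* s ≡ 1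
  as-ℕ = ℤP.+-injective (trans (trans (ℤP.pos-+ (p ℕ.* q) (r ℕ.* s)) (cong₂ _+_ (ℤP.pos-* p q) (ℤP.pos-* r s))) e)

αδ-βγ≡1⇒δ≡1∧γ≡1 : ∀ α β γ δ → + 0 ≤ β → β < α → + 1 ≤ γ → γ ≤ δ → α * δ - β * γ ≡ + 1 →
  δ ≡ + 1 × γ ≡ + 1
αδ-βγ≡1⇒δ≡1∧γ≡1 α β γ δ 0≤β β<α 1≤γ γ≤δ e =
  δ≡1 , ℤP.≤-antisym (subst (γ ≤_) δ≡1 γ≤δ) 1≤γ
  where
  -- αδ - βγ = (α - β) δ + β (δ - γ), a sum of a positive multiple of δ and a non-negative term.
  regroup : ∀ α β γ δ → α * δ - β * γ ≡ (α - β) * δ + β * (δ - γ)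
  regroup = solve-∀
  0<α-β : + 0 < α - β
  0<α-β = i<j⇒0<j-i β<α
  pd+bf≡1⇒d≡1 : ∀ p d b f → + 0 < p → + 1 ≤ d → + 0 ≤ b → + 0 ≤ f → p * d + b * f ≡ + 1 → d ≡ + 1
  pd+bf≡1⇒d≡1 (+ zero) d b f (+<+ ()) _ _ _ _
  pd+bf≡1⇒d≡1 (+ suc p) (+ zero) b f _ (+≤+ ()) _ _ _
  pd+bf≡1⇒d≡1 (+ suc p) (+ suc zero) b f _ _ _ _ _ = refl
  pd+bf≡1⇒d≡1 (+ suc p) (+ suc (suc d)) (+ b) (+ f) _ _ _ _ e = ⊥-elim (ℕP.<-irrefl refl
    (ℕP.≤-trans
      (ℕP.≤-trans (ℕP.*-mono-≤ (ℕ.s≤s (ℕ.z≤n {p})) (ℕ.s≤s (ℕ.s≤s (ℕ.z≤n {d})))) (ℕP.m≤m+n _ (b ℕ.* f)))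
      (ℕP.≤-reflexive (ℤP.+-injective (trans (trans (ℤP.pos-+ _ (b ℕ.* f))
        (cong₂ _+_ (ℤP.pos-* (suc p) (suc (suc d))) (ℤP.pos-* b f))) e)))))
  δ≡1 : δ ≡ + 1
  δ≡1 = pd+bf≡1⇒d≡1 (α - β) δ β (δ - γ) 0<α-β (ℤP.≤-trans 1≤γ γ≤δ) 0≤β (ℤP.i≤j⇒0≤j-i γ≤δ)
    (trans (sym (regroup α β γ δ)) e)

module Triangulated (T : ArcSet) (AT : AdmissibleTriangulation T) where

  private
    only-arcs : OnlyArcs T
    only-arcs = proj₁ (proj₁ AT)
    noncrossing : PairwiseNonCrossing T
    noncrossing = proj₁ (proj₂ (proj₁ AT))
    maximal : Maximal T
    maximal = proj₂ (proj₂ (proj₁ AT))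
    admissible : Admissible T
    admissible = proj₂ AT

  S : ℤ → ℤ → Set
  S = Side T

  S? : ∀ a b → Dec (S a b)
  S? a b with b ℤ.≟ a + + 1 | T a b Bool.≟ true
  ... | yes e | _ = yes (inj₁ e)
  ... | no _ | yes e = yes (inj₂ e)
  ... | no ¬e | no ¬e' = no λ { (inj₁ e) → ¬e e ; (inj₂ e) → ¬e' e }

  arc⇒i+1<j : ∀ {i j} → T i j ≡ true → i + + 1 < j
  arc⇒i+1<j {i} {j} e = IsArc⇒i+1<j i (only-arcs i j e)

  side⇒< : ∀ {i j} → S i j → i < j
  side⇒< {i} (inj₁ refl) = i<i+1 i
  side⇒< {i} (inj₂ e) = ℤP.<-trans (i<i+1 i) (arc⇒i+1<j e)

  side⇒arc : ∀ {i j} → S i j → i + + 1 < j → T i j ≡ true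
  side⇒arc (inj₁ refl) i+1<i+1 = ⊥-elim (ℤP.<-irrefl refl i+1<i+1)
  side⇒arc (inj₂ e) _ = e

  sides-noncrossing : ∀ {x y k l} → S x y → S k l → x < k → k < y → y < l → ⊥
  sides-noncrossing (inj₁ refl) _ x<k k<x+1 _ = i<j⇒j≮i+1 x<k k<x+1
  sides-noncrossing (inj₂ _) (inj₁ refl) _ k<y y<k+1 = i<j⇒j≮i+1 k<y y<k+1
  sides-noncrossing {x} {y} {k} {l} (inj₂ e) (inj₂ e') x<k k<y y<l = noncrossing x y k l e e' (inj₁ (x<k , k<y , y<l))

  uncrossed⇒arc : ∀ a b → a + + 1 < b →
    (∀ k l → T k l ≡ true → a < k → k < b → b < l → ⊥) →
    (∀ k l → T k l ≡ true → k < a → a < l → l < b → ⊥) → T a b ≡ true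
  uncrossed⇒arc a b a+1<b right left with T a b in eq
  ... | true = refl
  ... | false = ⊥-elim (maximal a b (i+1<j⇒IsArc a a+1<b) eq
    λ k l e → λ { (inj₁ (p , q , r)) → right k l e p q r ; (inj₂ (p , q , r)) → left k l e p q r })

  Apex : ℤ → ℤ → Set
  Apex a b = Σ ℤ λ c → a < c × c < b × S a c × S c b

  -- The apex is the largest c in (a, b) with a side (a, c); maximality of T makes (c, b) a side.
  apex : ∀ a b → T a b ≡ true → Apex a b
  apex a b ab with maximum (λ x → a < x × x < b × S a x) (λ x → a ℤ.<? x ×-dec x ℤ.<? b ×-dec S? a x)
      b (λ x p → ℤP.<⇒≤ (proj₁ (proj₂ p))) (a + + 1) (i<i+1 a , arc⇒i+1<j ab , inj₁ refl)
  ... | c , (a<c , c<b , ac) , c-max = c , a<c , c<b , ac , cb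
    where
    cb : S c b
    cb with i<j⇒j≡i+1⊎i+1<j c<b
    ... | inj₁ e = inj₁ e
    ... | inj₂ c+1<b = inj₂ (uncrossed⇒arc c b c+1<b right left)
      where
      right : ∀ k l → T k l ≡ true → c < k → k < b → b < l → ⊥
      right k l kl c<k k<b b<l = sides-noncrossing (inj₂ ab) (inj₂ kl) (ℤP.<-trans a<c c<k) k<b b<l
      left : ∀ k l → T k l ≡ true → k < c → c < l → l < b → ⊥
      left k l kl k<c c<l l<b with ℤP.<-cmp k a
      ... | tri< k<a _ _ = sides-noncrossing (inj₂ kl) (inj₂ ab) k<a (ℤP.<-trans a<c c<l) l<b
      ... | tri≈ _ refl _ = ℤP.<-irrefl refl (ℤP.<-≤-trans c<l (c-max l (ℤP.<-trans a<c c<l , l<b , inj₂ kl)))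
      ... | tri> _ _ a<k = sides-noncrossing ac (inj₂ kl) a<k k<c c<l

  apex-unique : ∀ {a b c c'} → a < c → c < b → S a c → S c b → a < c' → c' < b → S a c' → S c' b → c ≡ c'
  apex-unique {c = c} {c'} a<c c<b ac cb a<c' c'<b ac' c'b with ℤP.<-cmp c c'
  ... | tri< c<c' _ _ = ⊥-elim (sides-noncrossing ac' cb a<c c<c' c'<b)
  ... | tri≈ _ e _ = e
  ... | tri> _ _ c'<c = ⊥-elim (sides-noncrossing ac c'b a<c' c'<c c<b)

  left-neighbours-bounded : ∀ c → Σ ℤ λ m → ∀ x → x < c → S x c → m ≤ x
  left-neighbours-bounded c with admissible c
  ... | L , L-complete = min (c - + 1) L , bound
    where
    bound : ∀ x → x < c → S x c → min (c - + 1) L ≤ x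
    bound x _ (inj₁ refl) = subst (min (c - + 1) L ≤_) (i+1-1≡i x) (min≤⊤ (c - + 1) L)
    bound x _ (inj₂ e) = All.lookup (min≤xs (c - + 1) L) (L-complete x (inj₂ e))

  right-neighbours-bounded : ∀ c → Σ ℤ λ m → ∀ z → c < z → S c z → z ≤ m
  right-neighbours-bounded c with admissible c
  ... | L , L-complete = max (c + + 1) L , bound
    where
    bound : ∀ z → c < z → S c z → z ≤ max (c + + 1) L
    bound z _ (inj₁ refl) = ⊥≤max (c + + 1) L
    bound z _ (inj₂ e) = All.lookup (xs≤max (c + + 1) L) (L-complete z (inj₁ e))

  -- The triangle of T with middle vertex c; its outer vertices are the farthest
  -- neighbours of c, which exist by admissibility.
  record MiddleTriangle (c : ℤ) : Set where
    field
      left right : ℤ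
      left<c : left < c
      c<right : c < right
      left-side : S left c
      right-side : S c right
      outer-side : S left right
      left-farthest : ∀ x → x < c → S x c → left ≤ x
      right-farthest : ∀ z → c < z → S c z → z ≤ right

  abstract
    middle-triangle : ∀ c → MiddleTriangle c
    middle-triangle c = from-extremes
      (minimum (λ x → x < c × S x c) (λ x → x ℤ.<? c ×-dec S? x c) (proj₁ lower)
         (λ x p → proj₂ lower x (proj₁ p) (proj₂ p)) (c - + 1) (i-1<i c , inj₁ (sym (i-1+1≡i c))))
      (maximum (λ z → c < z × S c z) (λ z → c ℤ.<? z ×-dec S? c z) (proj₁ upper)
         (λ z p → proj₂ upper z (proj₁ p) (proj₂ p)) (c + + 1) (i<i+1 c , inj₁ refl))
      where
      lower : Σ ℤ λ m → ∀ x → x < c → S x c → m ≤ x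
      lower = left-neighbours-bounded c
      upper : Σ ℤ λ m → ∀ z → c < z → S c z → z ≤ m
      upper = right-neighbours-bounded c
      from-extremes : Minimum (λ x → x < c × S x c) → Maximum (λ z → c < z × S c z) → MiddleTriangle c
      from-extremes (a , (a<c , ac) , a-min) (b , (c<b , cb) , b-max) = record
        { left = a ; right = b ; left<c = a<c ; c<right = c<b ; left-side = ac ; right-side = cb
        ; outer-side = inj₂ (uncrossed⇒arc a b a+1<b right-uncrossed left-uncrossed)
        ; left-farthest = λ x x<c xc → a-min x (x<c , xc)
        ; right-farthest = λ z c<z cz → b-max z (c<z , cz)
        }
        where
        a+1<b : a + + 1 < b
        a+1<b with i<j⇒j≡i+1⊎i+1<j (ℤP.<-trans a<c c<b)
        ... | inj₁ refl = ⊥-elim (i<j⇒j≮i+1 a<c c<b)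
        ... | inj₂ p = p
        right-uncrossed : ∀ k l → T k l ≡ true → a < k → k < b → b < l → ⊥
        right-uncrossed k l kl a<k k<b b<l with ℤP.<-cmp k c
        ... | tri< k<c _ _ = sides-noncrossing ac (inj₂ kl) a<k k<c (ℤP.<-trans c<b b<l)
        ... | tri≈ _ refl _ = ℤP.<-irrefl refl (ℤP.<-≤-trans b<l (b-max l (ℤP.<-trans k<b b<l , inj₂ kl)))
        ... | tri> _ _ c<k = sides-noncrossing cb (inj₂ kl) c<k k<b b<l
        left-uncrossed : ∀ k l → T k l ≡ true → k < a → a < l → l < b → ⊥
        left-uncrossed k l kl k<a a<l l<b with ℤP.<-cmp l c
        ... | tri< l<c _ _ = sides-noncrossing (inj₂ kl) ac k<a a<l l<c
        ... | tri≈ _ refl _ = ℤP.<-irrefl refl (ℤP.<-≤-trans k<a (a-min k (ℤP.<-trans k<a a<l , inj₂ kl)))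
        ... | tri> _ _ c<l = sides-noncrossing (inj₂ kl) cb (ℤP.<-trans k<a a<c) c<l l<b

  middle-triangle-unique : ∀ {c} (m : MiddleTriangle c) {x z} → x < c → c < z → S x c → S c z → S x z →
    x ≡ MiddleTriangle.left m × z ≡ MiddleTriangle.right m
  middle-triangle-unique {c} m {x} {z} x<c c<z xc cz xz = x≡left , z≡right
    where
    open MiddleTriangle m
    x≡left : x ≡ left
    x≡left with ℤP.<-cmp left x
    ... | tri≈ _ e _ = sym e
    ... | tri> _ _ x<left = ⊥-elim (ℤP.<-irrefl refl (ℤP.<-≤-trans x<left (left-farthest x x<c xc)))
    ... | tri< left<x _ _ = ⊥-elim (sides-noncrossing left-side xz left<x x<c c<z)
    z≡right : z ≡ right
    z≡right with ℤP.<-cmp z right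
    ... | tri≈ _ e _ = e
    ... | tri> _ _ right<z = ⊥-elim (ℤP.<-irrefl refl (ℤP.<-≤-trans right<z (right-farthest z c<z cz)))
    ... | tri< z<right _ _ = ⊥-elim (sides-noncrossing xz right-side x<c c<z z<right)

  -- Grow a covering side one step at a time: the middle triangle at the right end b
  -- of a side (a, b) has an outer side reaching past b.
  covering-side : ∀ i j → i ≤ j → Σ ℤ λ a → Σ ℤ λ b → a ≤ i × j ≤ b × S a b
  covering-side i j i≤j with grow ℤ.∣ j - i ∣
    where
    grow : ∀ n → Σ ℤ λ a → Σ ℤ λ b → a ≤ i × i + + n ≤ b × S a b
    grow zero =
      i , i + + 1 , ℤP.≤-refl , ℤP.≤-trans (ℤP.≤-reflexive (ℤP.+-identityʳ i)) (ℤP.<⇒≤ (i<i+1 i)) , inj₁ refl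
    grow (suc n) with grow n
    ... | a , b , a≤i , i+n≤b , ab = left , right , ℤP.≤-trans left≤a a≤i , i+n+1≤right , outer-side
      where
      open MiddleTriangle (middle-triangle b)
      left≤a : left ≤ a
      left≤a with ℤP.<-cmp left a
      ... | tri< p _ _ = ℤP.<⇒≤ p
      ... | tri≈ _ e _ = ℤP.≤-reflexive e
      ... | tri> _ _ a<left = ⊥-elim (sides-noncrossing ab outer-side a<left left<c c<right)
      i+n+1≤right : i + + suc n ≤ right
      i+n+1≤right = subst (_≤ right) (sym (trans (cong (_+_ i) (cong +_ (ℕP.+-comm 1 n))) (sym (ℤP.+-assoc i (+ n) (+ 1)))))
        (i<j⇒i+1≤j (ℤP.≤-<-trans i+n≤b c<right))
  ... | a , b , a≤i , i+∣j-i∣≤b , ab = a , b , a≤i , subst (_≤ b) (sym (i≤j⇒j≡i+∣j-i∣ i≤j)) i+∣j-i∣≤b , ab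

  first third : Triple → ℤ
  first (p , _ , _) = p
  third (_ , _ , r) = r

  EndingAt StartingAt : ℤ → ℤ → Triple → Set
  EndingAt c x t = IsTriangle T t × third t ≡ c × x ≤ first t
  StartingAt c z t = IsTriangle T t × first t ≡ c × third t ≤ z

  Enumerates : (Triple → Set) → List Triple → Set
  Enumerates P L = Unique L × (∀ t → t ∈ L → P t) × (∀ t → P t → t ∈ L)

  UnimodularOn : (ℤ → ℤ²) → ℤ → ℤ → Set
  UnimodularOn v x y = ∀ p q → x ≤ p → q ≤ y → p < q → S p q → det (v p) (v q) ≡ + 1

  LeftFan RightFan : ℤ → ℤ → List Triple → Set
  LeftFan c x L = ∀ v → UnimodularOn v x c → v x ⊕ + length L · v c ≡ v (c - + 1)
  RightFan c z L = ∀ v → UnimodularOn v c z → v z ⊕ + length L · v c ≡ v (c + + 1)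

  private
    x⊕0·w≡x : ∀ x w → x ⊕ + 0 · w ≡ x
    x⊕0·w≡x (x₁ , x₂) (w₁ , w₂) = cong₂ _,_ (ℤP.+-identityʳ x₁) (ℤP.+-identityʳ x₂)
    x⊕[1+k]·w≡x⊕w⊕k·w : ∀ x w k → x ⊕ (+ 1 + k) · w ≡ x ⊕ w ⊕ k · w
    x⊕[1+k]·w≡x⊕w⊕k·w (x₁ , x₂) (w₁ , w₂) k = cong₂ _,_ (lemma x₁ w₁ k) (lemma x₂ w₂ k)
      where lemma : ∀ x w k → x + (+ 1 + k) * w ≡ (x + w) + k * w
            lemma = solve-∀
    ⊕-comm : ∀ x w → x ⊕ w ≡ w ⊕ x
    ⊕-comm (x₁ , x₂) (w₁ , w₂) = cong₂ _,_ (ℤP.+-comm x₁ w₁) (ℤP.+-comm x₂ w₂)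

  -- Below a side (x, c) the triangles ending at c form a fan: if y is the apex over (x, c),
  -- then v y = v x ⊕ v c, and the rest of the fan lies below (y, c).
  FanEndingAt FanStartingAt : ℤ → ℤ → Set
  FanEndingAt x c = S x c → Σ (List Triple) λ L → Enumerates (EndingAt c x) L × LeftFan c x L
  FanStartingAt c z = S c z → Σ (List Triple) λ L → Enumerates (StartingAt c z) L × RightFan c z L

  left-fan : ∀ x c → x < c → FanEndingAt x c
  left-fan = interval-induction FanEndingAt step
    where
    step : ∀ a b → a < b → OnSubintervals FanEndingAt a b → FanEndingAt a b
    step a b a<b ih ab with i<j⇒j≡i+1⊎i+1<j a<b
    ... | inj₁ refl = [] , ([] , (λ _ ()) , λ { (p , q , r) ((p<q , q<r , _) , refl , a≤p) →
                                                   ⊥-elim (i<j⇒j≮i+1 (ℤP.≤-<-trans a≤p p<q) q<r) })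
                    , λ v _ → trans (x⊕0·w≡x (v a) (v (a + + 1))) (cong v (sym (i+1-1≡i a)))
    ... | inj₂ a+1<b with apex a b (side⇒arc ab a+1<b)
    ... | y , a<y , y<b , ay , yb with onRight ih a<y y<b yb
    ... | L , (L-unique , L-sound , L-complete) , L-fan = (a , y , b) ∷ L , (new ∷ L-unique , sound , complete) , fan
      where
      fan : LeftFan b a ((a , y , b) ∷ L)
      fan v unimodular = trans (x⊕[1+k]·w≡x⊕w⊕k·w (v a) (v b) (+ length L))
        (trans (cong (_⊕ (+ length L · v b)) (sym (unimodular-triangle (v a) (v y) (v b)
            (unimodular a y ℤP.≤-refl (ℤP.<⇒≤ y<b) a<y ay) (unimodular y b (ℤP.<⇒≤ a<y) ℤP.≤-refl y<b yb)
            (unimodular a b ℤP.≤-refl ℤP.≤-refl a<b ab))))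
          (L-fan v (λ p q y≤p q≤b p<q pq → unimodular p q (ℤP.≤-trans (ℤP.<⇒≤ a<y) y≤p) q≤b p<q pq)))
      new : All ((a , y , b) ≢_) L
      new = All.tabulate λ {t} t∈L e → ℤP.<-irrefl (cong first e) (ℤP.<-≤-trans a<y (proj₂ (proj₂ (L-sound t t∈L))))
      sound : ∀ t → t ∈ (a , y , b) ∷ L → EndingAt b a t
      sound t (here refl) = (a<y , y<b , ay , yb , ab) , refl , ℤP.≤-refl
      sound t (there t∈L) with L-sound t t∈L
      ... | triangle , e , y≤ = triangle , e , ℤP.≤-trans (ℤP.<⇒≤ a<y) y≤
      complete : ∀ t → EndingAt b a t → t ∈ (a , y , b) ∷ L
      complete (p , q , r) (triangle@(p<q , q<r , pq , qr , pr) , refl , a≤p) with ℤP.<-cmp p y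
      ... | tri≈ _ refl _ = there (L-complete _ (triangle , refl , ℤP.≤-refl))
      ... | tri> _ _ y<p = there (L-complete _ (triangle , refl , ℤP.<⇒≤ y<p))
      ... | tri< p<y _ _ with i≤j⇒i≡j⊎i<j a≤p
      ... | inj₂ a<p = ⊥-elim (sides-noncrossing ay pr a<p p<y y<b)
      ... | inj₁ refl with apex-unique a<y y<b ay yb p<q q<r pq qr
      ... | refl = here refl

  right-fan : ∀ c z → c < z → FanStartingAt c z
  right-fan = interval-induction FanStartingAt step
    where
    step : ∀ a b → a < b → OnSubintervals FanStartingAt a b → FanStartingAt a b
    step a b a<b ih ab with i<j⇒j≡i+1⊎i+1<j a<b
    ... | inj₁ refl = [] , ([] , (λ _ ()) , λ { (p , q , r) ((p<q , q<r , _) , refl , r≤b) →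
                                                   ⊥-elim (i<j⇒j≮i+1 p<q (ℤP.<-≤-trans q<r r≤b)) })
                    , λ v _ → x⊕0·w≡x (v (a + + 1)) (v a)
    ... | inj₂ a+1<b with apex a b (side⇒arc ab a+1<b)
    ... | y , a<y , y<b , ay , yb with onLeft ih a<y y<b ay
    ... | L , (L-unique , L-sound , L-complete) , L-fan = (a , y , b) ∷ L , (new ∷ L-unique , sound , complete) , fan
      where
      fan : RightFan a b ((a , y , b) ∷ L)
      fan v unimodular = trans (x⊕[1+k]·w≡x⊕w⊕k·w (v b) (v a) (+ length L))
        (trans (cong (_⊕ (+ length L · v a)) (trans (⊕-comm (v b) (v a)) (sym (unimodular-triangle (v a) (v y) (v b)
            (unimodular a y ℤP.≤-refl (ℤP.<⇒≤ y<b) a<y ay) (unimodular y b (ℤP.<⇒≤ a<y) ℤP.≤-refl y<b yb)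
            (unimodular a b ℤP.≤-refl ℤP.≤-refl a<b ab)))))
          (L-fan v (λ p q a≤p q≤y p<q pq → unimodular p q a≤p (ℤP.≤-trans q≤y (ℤP.<⇒≤ y<b)) p<q pq)))
      new : All ((a , y , b) ≢_) L
      new = All.tabulate λ {t} t∈L e → ℤP.<-irrefl (sym (cong third e)) (ℤP.≤-<-trans (proj₂ (proj₂ (L-sound t t∈L))) y<b)
      sound : ∀ t → t ∈ (a , y , b) ∷ L → StartingAt a b t
      sound t (here refl) = (a<y , y<b , ay , yb , ab) , refl , ℤP.≤-refl
      sound t (there t∈L) with L-sound t t∈L
      ... | triangle , e , ≤y = triangle , e , ℤP.≤-trans ≤y (ℤP.<⇒≤ y<b)
      complete : ∀ t → StartingAt a b t → t ∈ (a , y , b) ∷ L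
      complete (p , q , r) (triangle@(p<q , q<r , pq , qr , pr) , refl , r≤b) with ℤP.<-cmp r y
      ... | tri≈ _ refl _ = there (L-complete _ (triangle , refl , ℤP.≤-refl))
      ... | tri< r<y _ _ = there (L-complete _ (triangle , refl , ℤP.<⇒≤ r<y))
      ... | tri> _ _ y<r with i≤j⇒i≡j⊎i<j r≤b
      ... | inj₂ r<b = ⊥-elim (sides-noncrossing pr yb a<y y<r r<b)
      ... | inj₁ refl with apex-unique p<q q<r pq qr a<y y<b ay yb
      ... | refl = here refl

  record TrianglesAt (c : ℤ) : Set where
    field
      middle : MiddleTriangle c
    open MiddleTriangle middle
    field
      ending starting : List Triple
      ending-enum : Enumerates (EndingAt c left) ending
      starting-enum : Enumerates (StartingAt c right) starting
      ending-fan : LeftFan c left ending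
      starting-fan : RightFan c right starting

    all : List Triple
    all = ending ++ (left , c , right) ∷ starting

    count : ℕ
    count = length ending ℕ.+ suc (length starting)

  abstract
    triangles-at : ∀ c → TrianglesAt c
    triangles-at c with middle-triangle c
    ... | m with left-fan _ c left<c left-side | right-fan c _ c<right right-side
      where open MiddleTriangle m
    ... | ending , ending-enum , ending-fan | starting , starting-enum , starting-fan = record
      { middle = m ; ending = ending ; starting = starting ; ending-enum = ending-enum
      ; starting-enum = starting-enum ; ending-fan = ending-fan ; starting-fan = starting-fan }

  triangleCount-at : ∀ c → TriangleCount T c (TrianglesAt.count (triangles-at c))
  triangleCount-at c = all , unique , sound , complete , length-++ ending
    where
    open TrianglesAt (triangles-at c)
    open MiddleTriangle middle
    mid : Triple
    mid = left , c , right
    mid∉starting : All (mid ≢_) starting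
    mid∉starting = All.tabulate λ {t} t∈ e →
      ℤP.<-irrefl (trans (cong first e) (proj₁ (proj₂ (proj₁ (proj₂ starting-enum) t t∈)))) left<c
    disjoint : ∀ {t} → t ∈ ending × t ∈ mid ∷ starting → ⊥
    disjoint {t} (t∈e , here refl) = ℤP.<-irrefl (sym (proj₁ (proj₂ (proj₁ (proj₂ ending-enum) t t∈e)))) c<right
    disjoint {t} (t∈e , there t∈s) with proj₁ (proj₂ ending-enum) t t∈e | proj₁ (proj₂ starting-enum) t t∈s
    ... | (p<q , q<r , _) , r≡c , _ | _ , p≡c , _ = ℤP.<-irrefl refl (subst₂ _<_ p≡c r≡c (ℤP.<-trans p<q q<r))
    unique : Unique all
    unique = Unique.++⁺ (proj₁ ending-enum) (mid∉starting ∷ proj₁ starting-enum) disjoint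
    sound : ∀ t → t ∈ all → IsTriangle T t × IncidentWith c t
    sound t t∈ with ∈-++⁻ ending t∈
    ... | inj₁ t∈e with proj₁ (proj₂ ending-enum) t t∈e
    ...   | triangle , r≡c , _ = triangle , inj₂ (inj₂ (sym r≡c))
    sound t t∈ | inj₂ (here refl) = (left<c , c<right , left-side , right-side , outer-side) , inj₂ (inj₁ refl)
    sound t t∈ | inj₂ (there t∈s) with proj₁ (proj₂ starting-enum) t t∈s
    ...   | triangle , p≡c , _ = triangle , inj₁ (sym p≡c)
    complete : ∀ t → IsTriangle T t → IncidentWith c t → t ∈ all
    complete (p , q , r) triangle@(p<q , q<r , pq , qr , pr) (inj₂ (inj₂ refl)) =
      ∈-++⁺ˡ (proj₂ (proj₂ ending-enum) _ (triangle , refl , left-farthest p (ℤP.<-trans p<q q<r) pr))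
    complete (p , q , r) triangle@(p<q , q<r , pq , qr , pr) (inj₂ (inj₁ refl))
      with middle-triangle-unique middle p<q q<r pq qr pr
    ... | refl , refl = ∈-++⁺ʳ ending (here refl)
    complete (p , q , r) triangle@(p<q , q<r , pq , qr , pr) (inj₁ refl) =
      ∈-++⁺ʳ ending (there (proj₂ (proj₂ starting-enum) _ (triangle , refl , right-farthest r (ℤP.<-trans p<q q<r) pr)))

triangleCount-unique : ∀ {T c m n} → TriangleCount T c m → TriangleCount T c n → m ≡ n
triangleCount-unique (L , L-unique , L-sound , L-complete , refl) (L' , L'-unique , L'-sound , L'-complete , refl) =
  Unique∧⊆∧⊇⇒length≡ L L' L-unique L'-unique
    (λ t t∈ → L'-complete t (proj₁ (L-sound t t∈)) (proj₂ (L-sound t t∈)))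
    (λ t t∈ → L-complete t (proj₁ (L'-sound t t∈)) (proj₂ (L'-sound t t∈)))

module FriezeOf (T : ArcSet) (AT : AdmissibleTriangulation T) where

  open Triangulated T AT

  triangle-count : ℤ → ℤ
  triangle-count c = + TrianglesAt.count (triangles-at c)

  open Recurrence triangle-count using (v; v-det; v-rec)

  Φ : ℤ → ℤ → ℤ
  Φ = detFrieze v

  -- A side (a, b) is the outer side of the middle triangle at its apex c, and the two fans
  -- at c together with the recurrence give v b = v c ⊝ v a.
  det-side≡1 : ∀ p q → p < q → S p q → det (v p) (v q) ≡ + 1
  det-side≡1 = interval-induction (λ p q → S p q → det (v p) (v q) ≡ + 1) step
    where
    step : ∀ a b → a < b → OnSubintervals (λ p q → S p q → det (v p) (v q) ≡ + 1) a b →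
           S a b → det (v a) (v b) ≡ + 1
    step a b a<b ih ab with i<j⇒j≡i+1⊎i+1<j a<b
    ... | inj₁ refl = v-det a
    ... | inj₂ a+1<b with apex a b (side⇒arc ab a+1<b)
    ... | c , a<c , c<b , ac , cb with middle-triangle-unique (TrianglesAt.middle (triangles-at c)) a<c c<b ac cb ab
    ... | refl , refl = trans (cong (det (v a)) vb≡vc⊝va) (trans (det-⊝ʳ (v a) (v c)) (onLeft ih a<c c<b ac))
      where
      open TrianglesAt (triangles-at c)
      unimodular-left : UnimodularOn v a c
      unimodular-left p q a≤p q≤c p<q =
        ih p q a≤p (ℤP.≤-trans q≤c (ℤP.<⇒≤ c<b)) p<q (inj₂ (ℤP.≤-<-trans q≤c c<b))
      unimodular-right : UnimodularOn v c b
      unimodular-right p q c≤p q≤b p<q =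
        ih p q (ℤP.≤-trans (ℤP.<⇒≤ a<c) c≤p) q≤b p<q (inj₁ (ℤP.<-≤-trans a<c c≤p))
      vb≡vc⊝va : v b ≡ v c ⊝ v a
      vb≡vc⊝va = fan-closes (v a) (v b) (v c) (v (c - + 1)) (v (c + + 1)) (+ length ending) (+ length starting)
        (sym (ending-fan v unimodular-left)) (sym (starting-fan v unimodular-right)) (v-rec c)

  OnesAreSides : ℤ → ℤ → Set
  OnesAreSides a b = ∀ x y → a ≤ x → x < y → y ≤ b → + 1 ≤ Φ x y × (Φ x y ≡ + 1 → S x y)

  private
    ones-are-sides-segment : ∀ a → OnesAreSides a (a + + 1)
    ones-are-sides-segment a x y a≤x x<y y≤a+1 with i≤j⇒i≡j⊎i<j a≤x | i≤j⇒i≡j⊎i<j y≤a+1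
    ... | inj₂ a<x | _ = ⊥-elim (i<j⇒j≮i+1 a<x (ℤP.<-≤-trans x<y y≤a+1))
    ... | _ | inj₂ y<a+1 = ⊥-elim (i<j⇒j≮i+1 (ℤP.≤-<-trans a≤x x<y) y<a+1)
    ... | inj₁ refl | inj₁ refl = ℤP.≤-reflexive (sym (v-det a)) , λ _ → inj₁ refl

    zero-or-positive : ∀ {a b x y} → OnesAreSides a b → a ≤ x → x ≤ y → y ≤ b → x ≡ y ⊎ + 1 ≤ Φ x y
    zero-or-positive sides a≤x x≤y y≤b with i≤j⇒i≡j⊎i<j x≤y
    ... | inj₁ x≡y = inj₁ x≡y
    ... | inj₂ x<y = inj₂ (proj₁ (sides _ _ a≤x x<y y≤b))

    nonnegative : ∀ {a b x y} → OnesAreSides a b → a ≤ x → x ≤ y → y ≤ b → + 0 ≤ Φ x y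
    nonnegative {x = x} sides a≤x x≤y y≤b with zero-or-positive sides a≤x x≤y y≤b
    ... | inj₁ refl = ℤP.≤-reflexive (sym (det-self (v x)))
    ... | inj₂ 1≤Φ = ℤP.≤-trans (+≤+ ℕ.z≤n) 1≤Φ

    zero⇒equal : ∀ {a b x y} → OnesAreSides a b → a ≤ x → x ≤ y → y ≤ b → Φ x y ≡ + 0 → x ≡ y
    zero⇒equal sides a≤x x≤y y≤b Φ≡0 with zero-or-positive sides a≤x x≤y y≤b
    ... | inj₁ x≡y = x≡y
    ... | inj₂ 1≤Φ = ⊥-elim (ℤP.<-irrefl (sym Φ≡0) (ℤP.<-≤-trans (+<+ (ℕ.s≤s ℕ.z≤n)) 1≤Φ))

    -- Writing v x and v y in the bases (v a, v c) and (v c, v b) expands Φ x y as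
    -- αγ + αδ + βδ with α, δ ≥ 1 and β, γ ≥ 0; it is 1 only when x = a and y = b.
    ones-are-sides-straddling : ∀ {a b c} → a < c → c < b → S a c → S c b → S a b →
      OnesAreSides a c → OnesAreSides c b →
      ∀ x y → a ≤ x → x < c → c < y → y ≤ b → + 1 ≤ Φ x y × (Φ x y ≡ + 1 → S x y)
    ones-are-sides-straddling {a} {b} {c} a<c c<b ac cb ab left right x y a≤x x<c c<y y≤b =
      subst (λ z → + 1 ≤ z × (z ≡ + 1 → S x y)) (sym Φxy≡) (proj₁ bound , one⇒side)
      where
      α β γ δ : ℤ
      α = det (v x) (v c)
      β = det (v a) (v x)
      γ = det (v y) (v b)
      δ = det (v c) (v y)
      bound : + 1 ≤ α * γ + α * δ + β * δ × (α * γ + α * δ + β * δ ≡ + 1 → γ ≡ + 0 × β ≡ + 0)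
      bound = positive-expansion α β γ δ
        (proj₁ (left x c a≤x x<c ℤP.≤-refl)) (nonnegative left ℤP.≤-refl a≤x (ℤP.<⇒≤ x<c))
        (nonnegative right (ℤP.<⇒≤ c<y) y≤b ℤP.≤-refl) (proj₁ (right c y ℤP.≤-refl c<y y≤b))
      vac : det (v a) (v c) ≡ + 1
      vac = det-side≡1 a c a<c ac
      vcb : det (v c) (v b) ≡ + 1
      vcb = det-side≡1 c b c<b cb
      Φxy≡ : Φ x y ≡ α * γ + α * δ + β * δ
      Φxy≡ = trans (cong₂ det (cramer (v a) (v c) (v x) vac) (cramer (v c) (v b) (v y) vcb))
        (det-expand (v a) (v b) (v c) α β γ δ vac (det-side≡1 a b (ℤP.<-trans a<c c<b) ab) vcb)
      one⇒side : α * γ + α * δ + β * δ ≡ + 1 → S x y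
      one⇒side e with proj₂ bound e
      ... | γ≡0 , β≡0 = subst₂ S (zero⇒equal left ℤP.≤-refl a≤x (ℤP.<⇒≤ x<c) β≡0)
                                 (sym (zero⇒equal right (ℤP.<⇒≤ c<y) y≤b ℤP.≤-refl γ≡0)) ab

  ones-are-sides : ∀ a b → a < b → S a b → OnesAreSides a b
  ones-are-sides = interval-induction (λ a b → S a b → OnesAreSides a b) step
    where
    step : ∀ a b → a < b → OnSubintervals (λ a b → S a b → OnesAreSides a b) a b → S a b → OnesAreSides a b
    step a b a<b ih ab with i<j⇒j≡i+1⊎i+1<j a<b
    ... | inj₁ refl = ones-are-sides-segment a
    ... | inj₂ a+1<b with apex a b (side⇒arc ab a+1<b)
    ... | c , a<c , c<b , ac , cb = glue
      where
      left : OnesAreSides a c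
      left = onLeft ih a<c c<b ac
      right : OnesAreSides c b
      right = onRight ih a<c c<b cb
      glue : OnesAreSides a b
      glue x y a≤x x<y y≤b with y ℤ.≤? c | c ℤ.≤? x
      ... | yes y≤c | _ = left x y a≤x x<y y≤c
      ... | no _ | yes c≤x = right x y c≤x x<y y≤b
      ... | no y≰c | no c≰x =
        ones-are-sides-straddling a<c c<b ac cb ab left right x y a≤x (ℤP.≰⇒> c≰x) (ℤP.≰⇒> y≰c) y≤b

  Φ-isSL₂Frieze : IsSL₂Frieze Φ
  Φ-isSL₂Frieze = detFrieze-isSL₂Frieze v v-det

  Φ-positive : ∀ i j → i < j → + 1 ≤ Φ i j
  Φ-positive i j i<j with covering-side i j (ℤP.<⇒≤ i<j)
  ... | a , b , a≤i , j≤b , ab = proj₁ (ones-are-sides a b (side⇒< ab) ab i j a≤i i<j j≤b)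

  Φ≡1⇒side : ∀ i j → i < j → Φ i j ≡ + 1 → S i j
  Φ≡1⇒side i j i<j with covering-side i j (ℤP.<⇒≤ i<j)
  ... | a , b , a≤i , j≤b , ab = proj₂ (ones-are-sides a b (side⇒< ab) ab i j a≤i i<j j≤b)

  Φ-isInfiniteFrieze : IsInfiniteFrieze Φ
  Φ-isInfiniteFrieze = diagonal , Φ-positive , boundary , antisym , diamond
    where open IsSL₂Frieze Φ-isSL₂Frieze

  Φ-isΦ : IsΦ T Φ
  Φ-isΦ = Φ-isInfiniteFrieze , λ i →
    TrianglesAt.count (triangles-at i) , triangleCount-at i , quiddity-detFrieze triangle-count i

  Φ-enoughOnes : EnoughOnes Φ
  Φ-enoughOnes i j i≤j with covering-side i j i≤j
  ... | a , b , a≤i , j≤b , ab = a , b , a≤i , j≤b , det-side≡1 a b (side⇒< ab) ab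

  IsΦ⇒≡Φ : ∀ t → IsΦ T t → ∀ i j → t i j ≡ Φ i j
  IsΦ⇒≡Φ t (tF , counts) =
    frieze-unique (IsInfiniteFrieze⇒IsSL₂Frieze tF) (proj₁ (proj₂ tF)) Φ-isSL₂Frieze same-quiddity
    where
    same-quiddity : ∀ i → quiddity t i ≡ quiddity Φ i
    same-quiddity i with counts i
    ... | n , count , e = trans e (trans (cong +_ (triangleCount-unique count (triangleCount-at i)))
                                         (sym (quiddity-detFrieze triangle-count i)))

module TriangulationOf (t : ℤ → ℤ → ℤ) (tF : IsInfiniteFrieze t) (enough-ones : EnoughOnes t) where

  private
    t-diagonal : ∀ i → t i i ≡ + 0
    t-diagonal = proj₁ tF
    t-positive : ∀ i j → i < j → + 1 ≤ t i j
    t-positive = proj₁ (proj₂ tF)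
    t-boundary : ∀ i → t i (i + + 1) ≡ + 1
    t-boundary = proj₁ (proj₂ (proj₂ tF))

  open Recurrence (quiddity t) using (v; v-det; v-rec)

  t≡det : ∀ i j → t i j ≡ det (v i) (v j)
  t≡det = frieze-unique (IsInfiniteFrieze⇒IsSL₂Frieze tF) t-positive (detFrieze-isSL₂Frieze v v-det)
    (λ i → sym (quiddity-detFrieze (quiddity t) i))

  t-nonnegative : ∀ i j → i ≤ j → + 0 ≤ t i j
  t-nonnegative i j i≤j with i≤j⇒i≡j⊎i<j i≤j
  ... | inj₁ refl = ℤP.≤-reflexive (sym (t-diagonal i))
  ... | inj₂ i<j = ℤP.≤-trans (+≤+ ℕ.z≤n) (t-positive i j i<j)

  ptolemy : ∀ a b x → t a (x + + 1) * t x b - t a x * t (x + + 1) b ≡ t a b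
  ptolemy a b x = begin
    t a x′ * t x b - t a x * t x′ b
      ≡⟨ cong₂ _-_ (cong₂ _*_ (t≡det a x′) (t≡det x b)) (cong₂ _*_ (t≡det a x) (t≡det x′ b)) ⟩
    det (v a) (v x′) * det (v x) (v b) - det (v a) (v x) * det (v x′) (v b)
      ≡⟨ cong (_-_ (det (v a) (v x′) * det (v x) (v b))) (plücker (v a) (v x) (v x′) (v b)) ⟩
    det (v a) (v x′) * det (v x) (v b) - (det (v a) (v x′) * det (v x) (v b) - det (v a) (v b) * det (v x) (v x′))
      ≡⟨ cancel (det (v a) (v x′) * det (v x) (v b)) (det (v a) (v b)) (det (v x) (v x′)) ⟩
    det (v a) (v b) * det (v x) (v x′)
      ≡⟨ cong₂ _*_ (sym (t≡det a b)) (v-det x) ⟩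
    t a b * + 1
      ≡⟨ ℤP.*-identityʳ (t a b) ⟩
    t a b ∎
    where
    open ≡-Reasoning
    x′ : ℤ
    x′ = x + + 1
    cancel : ∀ p q r → p - (p - q * r) ≡ q * r
    cancel = solve-∀

  T₁ : ArcSet
  T₁ i j = does (i + + 2 ℤ.≤? j) ∧ does (t i j ℤ.≟ + 1)

  T₁⇒arc∧one : ∀ {i j} → T₁ i j ≡ true → IsArc i j × t i j ≡ + 1
  T₁⇒arc∧one {i} {j} e with i + + 2 ℤ.≤? j | t i j ℤ.≟ + 1
  T₁⇒arc∧one {i} {j} e | yes arc | yes one = arc , one
  T₁⇒arc∧one {i} {j} () | yes _ | no _
  T₁⇒arc∧one {i} {j} () | no _ | _

  arc∧one⇒T₁ : ∀ {i j} → IsArc i j → t i j ≡ + 1 → T₁ i j ≡ true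
  arc∧one⇒T₁ {i} {j} arc one with i + + 2 ℤ.≤? j | t i j ℤ.≟ + 1
  ... | yes _ | yes _ = refl
  ... | yes _ | no ¬one = ⊥-elim (¬one one)
  ... | no ¬arc | _ = ⊥-elim (¬arc arc)

  i+1<j∧one⇒T₁ : ∀ {i j} → i + + 1 < j → t i j ≡ + 1 → T₁ i j ≡ true
  i+1<j∧one⇒T₁ {i} i+1<j = arc∧one⇒T₁ (i+1<j⇒IsArc i i+1<j)

  side⇒one : ∀ {i j} → Side T₁ i j → t i j ≡ + 1
  side⇒one {i} (inj₁ refl) = t-boundary i
  side⇒one (inj₂ e) = proj₂ (T₁⇒arc∧one e)

  -- For x < k < y < l, Plücker gives t x k · t y l + t x l · t k y = t x y · t k l,
  -- and the left side is at least 2.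
  ones-noncrossing : ∀ {x k y l} → x < k → k < y → y < l → t x y ≡ + 1 → t k l ≡ + 1 → ⊥
  ones-noncrossing {x} {k} {y} {l} x<k k<y y<l xy≡1 kl≡1 =
    pos*pos+pos*pos≢1 (t x k) (t y l) (t x l) (t k y) (t-positive x k x<k) (t-positive y l y<l)
      (t-positive x l (ℤP.<-trans x<k (ℤP.<-trans k<y y<l))) (t-positive k y k<y) (begin
        t x k * t y l + t x l * t k y
          ≡⟨ cong₂ _+_ (cong₂ _*_ (t≡det x k) (t≡det y l)) (cong₂ _*_ (t≡det x l) (t≡det k y)) ⟩
        det (v x) (v k) * det (v y) (v l) + det (v x) (v l) * det (v k) (v y)
          ≡⟨ cong (_+ det (v x) (v l) * det (v k) (v y)) (plücker (v x) (v k) (v y) (v l)) ⟩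
        det (v x) (v y) * det (v k) (v l) - det (v x) (v l) * det (v k) (v y) + det (v x) (v l) * det (v k) (v y)
          ≡⟨ sub-add (det (v x) (v y) * det (v k) (v l)) (det (v x) (v l) * det (v k) (v y)) ⟩
        det (v x) (v y) * det (v k) (v l)
          ≡⟨ cong₂ _*_ (trans (sym (t≡det x y)) xy≡1) (trans (sym (t≡det k l)) kl≡1) ⟩
        + 1 ∎)
    where
    open ≡-Reasoning
    sub-add : ∀ p q → p - q + q ≡ p
    sub-add = solve-∀

  T₁-onlyArcs : OnlyArcs T₁
  T₁-onlyArcs i j e = proj₁ (T₁⇒arc∧one e)

  T₁-noncrossing : PairwiseNonCrossing T₁
  T₁-noncrossing i j k l ij kl (inj₁ (i<k , k<j , j<l)) =
    ones-noncrossing i<k k<j j<l (proj₂ (T₁⇒arc∧one ij)) (proj₂ (T₁⇒arc∧one kl))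
  T₁-noncrossing i j k l ij kl (inj₂ (k<i , i<l , l<j)) =
    ones-noncrossing k<i i<l l<j (proj₂ (T₁⇒arc∧one kl)) (proj₂ (T₁⇒arc∧one ij))

  -- Take the largest x in [a, b) with t a x < t x b; at x + 1 the inequality fails, and
  -- ptolemy at x with t a b = 1 forces t a (x + 1) = t (x + 1) b = 1.
  farey-split : ∀ a b → a + + 1 < b → t a b ≡ + 1 → Σ ℤ λ c → a < c × c < b × t a c ≡ + 1 × t c b ≡ + 1
  farey-split a b a+1<b ab≡1
    with maximum (λ x → a ≤ x × x < b × t a x < t x b) (λ x → a ℤ.≤? x ×-dec x ℤ.<? b ×-dec t a x ℤ.<? t x b)
      b (λ x p → ℤP.<⇒≤ (proj₁ (proj₂ p)))
      a (ℤP.≤-refl , ℤP.<-trans (i<i+1 a) a+1<b , subst₂ _<_ (sym (t-diagonal a)) (sym ab≡1) (+<+ (ℕ.s≤s ℕ.z≤n)))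
  ... | x , (a≤x , x<b , ax<xb) , x-max with i<j⇒j≡i+1⊎i+1<j x<b
  ... | inj₂ x+1<b = x + + 1 , ℤP.≤-<-trans a≤x (i<i+1 x) , x+1<b , ones
    where
    x+1-fails : ¬ t a (x + + 1) < t (x + + 1) b
    x+1-fails lt = ℤP.<-irrefl refl
      (ℤP.<-≤-trans (i<i+1 x) (x-max (x + + 1) (ℤP.≤-trans a≤x (ℤP.<⇒≤ (i<i+1 x)) , x+1<b , lt)))
    ones : t a (x + + 1) ≡ + 1 × t (x + + 1) b ≡ + 1
    ones = αδ-βγ≡1⇒δ≡1∧γ≡1 (t x b) (t a x) (t (x + + 1) b) (t a (x + + 1))
      (t-nonnegative a x a≤x) ax<xb (t-positive (x + + 1) b x+1<b) (ℤP.≮⇒≥ x+1-fails)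
      (trans (cong (_- t a x * t (x + + 1) b) (ℤP.*-comm (t x b) (t a (x + + 1)))) (trans (ptolemy a b x) ab≡1))
  ... | inj₁ refl = ⊥-elim (ℤP.<-irrefl refl (subst (λ z → z + + 1 < x + + 1) a≡x a+1<b))
    where
    ax≡0 : t a x ≡ + 0
    ax≡0 = ℤP.≤-antisym (i<j+1⇒i≤j {j = + 0} (subst (t a x <_) (t-boundary x) ax<xb)) (t-nonnegative a x a≤x)
    a≡x : a ≡ x
    a≡x with i≤j⇒i≡j⊎i<j a≤x
    ... | inj₁ e = e
    ... | inj₂ a<x = ⊥-elim (ℤP.<-irrefl (sym ax≡0) (ℤP.<-≤-trans (+<+ (ℕ.s≤s ℕ.z≤n)) (t-positive a x a<x)))

  -- Descend through 1-arcs containing (i, j), splitting each at its Farey point,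
  -- until a piece crosses (i, j).
  one-crossing : ∀ i j → i + + 1 < j → t i j ≢ + 1 → ∀ a b → a < b → t a b ≡ + 1 → a ≤ i → j ≤ b →
    Σ ℤ λ k → Σ ℤ λ l → T₁ k l ≡ true × Cross i j k l
  one-crossing i j i+1<j ij≢1 = interval-induction Crossing step
    where
    Crossing : ℤ → ℤ → Set
    Crossing a b = t a b ≡ + 1 → a ≤ i → j ≤ b → Σ ℤ λ k → Σ ℤ λ l → T₁ k l ≡ true × Cross i j k l
    i<j : i < j
    i<j = ℤP.<-trans (i<i+1 i) i+1<j
    step : ∀ a b → a < b → OnSubintervals Crossing a b → Crossing a b
    step a b a<b ih ab≡1 a≤i j≤b with i<j⇒j≡i+1⊎i+1<j a<b
    ... | inj₁ refl with i≤j⇒i≡j⊎i<j a≤i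
    ...   | inj₁ refl = ⊥-elim (ℤP.<-irrefl refl (ℤP.<-≤-trans i+1<j j≤b))
    ...   | inj₂ a<i = ⊥-elim (i<j⇒j≮i+1 a<i (ℤP.<-≤-trans i<j j≤b))
    step a b a<b ih ab≡1 a≤i j≤b | inj₂ a+1<b with farey-split a b a+1<b ab≡1
    ... | c , a<c , c<b , ac≡1 , cb≡1 with j ℤ.≤? c | c ℤ.≤? i
    ... | yes j≤c | _ = onLeft ih a<c c<b ac≡1 a≤i j≤c
    ... | no _ | yes c≤i = onRight ih a<c c<b cb≡1 c≤i j≤b
    ... | no j≰c | no c≰i with ℤP.≰⇒> c≰i | ℤP.≰⇒> j≰c | i≤j⇒i≡j⊎i<j a≤i | i≤j⇒i≡j⊎i<j j≤b
    ... | i<c | c<j | inj₂ a<i | _ =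
      a , c , i+1<j∧one⇒T₁ (ℤP.≤-<-trans (i<j⇒i+1≤j a<i) i<c) ac≡1 , inj₂ (a<i , i<c , c<j)
    ... | i<c | c<j | inj₁ refl | inj₂ j<b =
      c , b , i+1<j∧one⇒T₁ (ℤP.≤-<-trans (i<j⇒i+1≤j c<j) j<b) cb≡1 , inj₁ (i<c , c<j , j<b)
    ... | _ | _ | inj₁ refl | inj₁ refl = ⊥-elim (ij≢1 ab≡1)

  T₁-maximal : Maximal T₁
  T₁-maximal i j arc ij∉T₁ uncrossed with enough-ones i j (ℤP.<⇒≤ i<j)
    where
    i<j : i < j
    i<j = ℤP.<-trans (i<i+1 i) (IsArc⇒i+1<j i arc)
  ... | a , b , a≤i , j≤b , ab≡1 with one-crossing i j (IsArc⇒i+1<j i arc) ij≢1 a b a<b ab≡1 a≤i j≤b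
    where
    ij≢1 : t i j ≢ + 1
    ij≢1 one with trans (sym ij∉T₁) (arc∧one⇒T₁ arc one)
    ... | ()
    a<b : a < b
    a<b = ℤP.≤-<-trans a≤i (ℤP.<-≤-trans (ℤP.<-trans (i<i+1 i) (IsArc⇒i+1<j i arc)) j≤b)
  ... | k , l , kl , cross = uncrossed k l kl cross

  -- All arcs at i stay inside a 1-arc (a, b) with a < i < b, which they cannot cross.
  T₁-admissible : Admissible T₁
  T₁-admissible i with enough-ones (i - + 1) (i + + 1) (ℤP.<⇒≤ (ℤP.<-trans (i-1<i i) (i<i+1 i)))
  ... | a , b , a≤i-1 , i+1≤b , ab≡1 = range a ℤ.∣ b - a ∣ , λ j ij → ∈-range-between a b j (a≤ j ij) (≤b j ij)
    where
    a<i : a < i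
    a<i = ℤP.≤-<-trans a≤i-1 (i-1<i i)
    i<b : i < b
    i<b = ℤP.<-≤-trans (i<i+1 i) i+1≤b
    a≤ : ∀ j → T₁ i j ≡ true ⊎ T₁ j i ≡ true → a ≤ j
    a≤ j (inj₁ ij) = ℤP.<⇒≤ (ℤP.<-trans a<i (ℤP.<-trans (i<i+1 i) (IsArc⇒i+1<j i (proj₁ (T₁⇒arc∧one ij)))))
    a≤ j (inj₂ ji) with a ℤ.≤? j
    ... | yes a≤j = a≤j
    ... | no a≰j = ⊥-elim (ones-noncrossing (ℤP.≰⇒> a≰j) a<i i<b (proj₂ (T₁⇒arc∧one ji)) ab≡1)
    ≤b : ∀ j → T₁ i j ≡ true ⊎ T₁ j i ≡ true → j ≤ b
    ≤b j (inj₂ ji) = ℤP.<⇒≤ (ℤP.<-trans (ℤP.<-trans (i<i+1 j) (IsArc⇒i+1<j j (proj₁ (T₁⇒arc∧one ji)))) i<b)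
    ≤b j (inj₁ ij) with j ℤ.≤? b
    ... | yes j≤b = j≤b
    ... | no j≰b = ⊥-elim (ones-noncrossing a<i i<b (ℤP.≰⇒> j≰b) ab≡1 (proj₂ (T₁⇒arc∧one ij)))

  T₁-admissibleTriangulation : AdmissibleTriangulation T₁
  T₁-admissibleTriangulation = (T₁-onlyArcs , T₁-noncrossing , T₁-maximal) , T₁-admissible

  open Triangulated T₁ T₁-admissibleTriangulation using (MiddleTriangle; TrianglesAt; triangles-at; triangleCount-at)

  t-isΦ : IsΦ T₁ t
  t-isΦ = tF , λ c → TrianglesAt.count (triangles-at c) , triangleCount-at c , quiddity≡count c
    where
    side⇒det≡1 : ∀ {p q} → Side T₁ p q → det (v p) (v q) ≡ + 1
    side⇒det≡1 {p} {q} pq = trans (sym (t≡det p q)) (side⇒one pq)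
    quiddity≡count : ∀ c → quiddity t c ≡ + TrianglesAt.count (triangles-at c)
    quiddity≡count c = fan-coefficient (v left) (v right) (v c) (v (c - + 1)) (v (c + + 1)) (v (c + + 1))
      (+ length ending) (+ length starting) (quiddity t c)
      (sym (ending-fan v λ _ _ _ _ _ → side⇒det≡1)) (sym (starting-fan v λ _ _ _ _ _ → side⇒det≡1)) (v-rec c)
      (unimodular-triangle (v left) (v c) (v right) (side⇒det≡1 left-side) (side⇒det≡1 right-side) (side⇒det≡1 outer-side))
      (v-det c)
      where
      open TrianglesAt (triangles-at c)
      open MiddleTriangle middle

-- An arc of T has t = 1, and every pair with t = 1 is a side of T'.
arcs-determined-by-Φ : ∀ T T' t → AdmissibleTriangulation T → AdmissibleTriangulation T' →
  IsΦ T t → IsΦ T' t → ∀ i j → T i j ≡ true → T' i j ≡ true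
arcs-determined-by-Φ T T' t AT AT' isΦ isΦ' i j ij =
  Triangulated.side⇒arc T' AT' (FriezeOf.Φ≡1⇒side T' AT' i j i<j t'ij≡1) (Triangulated.arc⇒i+1<j T AT ij)
  where
  i<j : i < j
  i<j = ℤP.<-trans (i<i+1 i) (Triangulated.arc⇒i+1<j T AT ij)
  t'ij≡1 : FriezeOf.Φ T' AT' i j ≡ + 1
  t'ij≡1 = trans (sym (FriezeOf.IsΦ⇒≡Φ T' AT' t isΦ' i j))
             (trans (FriezeOf.IsΦ⇒≡Φ T AT t isΦ i j) (FriezeOf.det-side≡1 T AT i j i<j (inj₂ ij)))

Φ-injective : ∀ T T' t → AdmissibleTriangulation T → AdmissibleTriangulation T' →
  IsΦ T t → IsΦ T' t → ∀ i j → T i j ≡ T' i j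
Φ-injective T T' t AT AT' isΦ isΦ' i j = ⇔→≡ {z = true} (mk⇔
  (arcs-determined-by-Φ T T' t AT AT' isΦ isΦ' i j) (arcs-determined-by-Φ T' T t AT' AT isΦ' isΦ i j))

proposition3p7 :
    ((T : ArcSet) → AdmissibleTriangulation T →
       Σ (ℤ → ℤ → ℤ) λ t → IsΦ T t × EnoughOnes t)
  × ((T T' : ArcSet) (t : ℤ → ℤ → ℤ) →
       AdmissibleTriangulation T → AdmissibleTriangulation T' →
       IsΦ T t → IsΦ T' t → ∀ i j → T i j ≡ T' i j)
  × ((t : ℤ → ℤ → ℤ) → IsInfiniteFrieze t → EnoughOnes t →
       Σ ArcSet λ T → AdmissibleTriangulation T × IsΦ T t)
proposition3p7 =
    (λ T AT → let open FriezeOf T AT in Φ , Φ-isΦ , Φ-enoughOnes)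
  , Φ-injective
  , (λ t tF ones → let open TriangulationOf t tF ones in T₁ , T₁-admissibleTriangulation , t-isΦ)
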